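{- Let $a,b,c$ be positive integers with $c\ge 2$ and $\gcd(a,c)=\gcd(b,c)=1$, and let $t$ be an integer. Let $a^{ -1}$ denote an integer with $a a^{ -1}\equiv 1 \pmod c$, let $c_1$ be the least nonnegative residue of $-a^{ -1}b$ modulo $c$, and, when $c_1\ge 1$, let $c_2$ be the least nonnegative residue of $c$ modulo $c_1$. Define \[ \sigma_t(a,b;c)=\sum_{m=0}^{c-1}\left(\!\left(\frac{ -a^{ -1}(bm+t)}{c}\right)\!\right)\left(\!\left(\frac{m}{c}\right)\!\right), \qquad ((x)) = x-\lfloor x\rfloor-\tfrac12 . \] Then: (i) If $c_1=1$, then $\displaystyle \sigma_t(a,b;c)\ge -\frac{c}{24}+\frac{1}{6c}-\frac34$. (ii) If $c_1\ne 1$ and $c_2=1$, then $\displaystyle \sigma_t(a,b;c)\ge \frac{c_1}{12c}+\frac{1}{12c_1c}-\frac{c}{24c_1}-\frac{1}{6c_1}-\frac{c_1}{12}-\frac34$. (iii) If $c_1\ne 1$ and $c_2\ne 1$, then \[ \sigma_t(a,b;c)\ge \frac{c_1}{12c}+\frac{1}{12c_1c}-\frac{c}{24c_1}-\frac{c_2}{12c_1}-\frac{1}{12c_1c_2}-\frac{c_1}{12c_2}-\frac34-\sqrt{\left(\frac{c_2}{12}+\frac{1}{6c_2}\right)\left(\frac{c_2}{12}-\frac14+\frac{1}{6c_2}\right)} . \]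
   Context: $\lfloor x\rfloor$ denotes the greatest integer not exceeding $x$. The sum $\sigma_t(a,b;c)$ does not depend on the choice of the inverse $a^{ -1}$ modulo $c$. -}

module Defs where

open import Data.Nat as ℕ using (ℕ; zero; suc)
open import Data.Integer as ℤ using (ℤ; +_)
import Data.Integer.DivMod as ℤD
open import Data.Sum using (_⊎_)
open import Data.Rational as ℚ using (ℚ; floor; ½)

-- Total versions of division/modulo by a natural number.  They are only
-- ever applied to nonzero denominators in the theorem (c ≥ 2, c₁ ≥ 1,
-- c₂ ≥ 1 all hold under the hypotheses); the value at 0 is an arbitrary
-- convention (n / 0 = 0, n mod 0 = n).

_/'_ : ℤ → ℕ → ℚ
n /' zero = ℚ.0ℚ
n /' suc d = n ℚ./ suc d

_modℤ_ : ℤ → ℕ → ℕ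
n modℤ zero = ℤ.∣ n ∣
n modℤ suc d = n ℤD.%ℕ suc d

_modℕ_ : ℕ → ℕ → ℕ
n modℕ zero = n
n modℕ suc d = n ℕ.% suc d

saw : ℚ → ℚ
saw x = x ℚ.- (floor x ℚ./ 1) ℚ.- ½

Σ< : ℕ → (ℕ → ℚ) → ℚ
Σ< zero f = ℚ.0ℚ
Σ< (suc n) f = Σ< n f ℚ.+ f n

σ : (t : ℤ) (b c : ℕ) (ainv : ℤ) → ℚ
σ t b c ainv =
  Σ< c (λ m → saw ((ℤ.- (ainv ℤ.* (+ b ℤ.* + m ℤ.+ t))) /' c) ℚ.* saw ((+ m) /' c))

c₁ : (b c : ℕ) (ainv : ℤ) → ℕ
c₁ b c ainv = (ℤ.- (ainv ℤ.* + b)) modℤ c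

c₂ : (b c : ℕ) (ainv : ℤ) → ℕ
c₂ b c ainv = c modℕ (c₁ b c ainv)

ι : ℕ → ℚ
ι n = + n ℚ./ 1

bound₁ : ℕ → ℚ
bound₁ c = ℚ.- ((+ c) /' 24) ℚ.+ ((+ 1) /' (6 ℕ.* c)) ℚ.- ((+ 3) /' 4)

bound₂ : ℕ → ℕ → ℚ
bound₂ c k = (+ k) /' (12 ℕ.* c) ℚ.+ (+ 1) /' (12 ℕ.* k ℕ.* c) ℚ.- (+ c) /' (24 ℕ.* k)
  ℚ.- (+ 1) /' (6 ℕ.* k) ℚ.- (+ k) /' 12 ℚ.- (+ 3) /' 4

-- bound (iii) without the square-root term
bound₃ : ℕ → ℕ → ℕ → ℚ
bound₃ c k l = (+ k) /' (12 ℕ.* c) ℚ.+ (+ 1) /' (12 ℕ.* k ℕ.* c) ℚ.- (+ c) /' (24 ℕ.* k)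
  ℚ.- (+ l) /' (12 ℕ.* k) ℚ.- (+ 1) /' (12 ℕ.* k ℕ.* l) ℚ.- (+ k) /' (12 ℕ.* l) ℚ.- (+ 3) /' 4

radicand₃ : ℕ → ℚ
radicand₃ l = ((+ l) /' 12 ℚ.+ (+ 1) /' (6 ℕ.* l))
  ℚ.* ((+ l) /' 12 ℚ.- (+ 1) /' 4 ℚ.+ (+ 1) /' (6 ℕ.* l))

-- "x ≥ y - √r" for rational x, y and r ≥ 0, expressed without square roots:
-- y - x ≤ √r  ⇔  y - x ≤ 0  or  (y - x)² ≤ r
_≥_-√_ : ℚ → ℚ → ℚ → Set
x ≥ y -√ r = (y ℚ.- x ℚ.≤ ℚ.0ℚ) ⊎ ((y ℚ.- x) ℚ.* (y ℚ.- x) ℚ.≤ r)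

module Submission where

open import Defs
open import Data.Nat using (ℕ; _≤_)
open import Data.Nat.GCD using (gcd)
open import Data.Integer using (ℤ; +_; _*_; _-_)
open import Data.Integer.Divisibility using (_∣_)
open import Data.Rational using (ℚ) renaming (_≤_ to _≤ℚ_)
open import Data.Product using (_×_)
open import Relation.Binary.PropositionalEquality using (_≡_; _≢_)

open import Data.Nat as ℕ using (zero; suc; NonZero; _<_; _⊓_; z≤n; s≤s; z<s)
import Data.Nat.Properties as ℕP
open import Data.Nat.DivMod using (_%_; _/_; m≡m%n+[m/n]*n; m%n<n; m/n*n≤m; m*n/n≡m; /-monoˡ-≤; m<n*o⇒m/o<n; m<n⇒m%n≡m)
import Data.Nat.Divisibility as ℕ∣
open import Data.Nat.Coprimality as Coprimality using (Coprime; coprime-divisor)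
open import Data.Nat.GCD using (gcd-greatest; gcd[m,n]≢0)
import Data.Nat.Tactic.RingSolver as ℕSolver
open import Data.Integer as ℤ using (_+_; -_; 0ℤ; 1ℤ; +≤+; +<+) renaming (_≤_ to _≤ℤ_; _<_ to _<ℤ_)
import Data.Integer.Properties as ℤP
open import Data.Integer.DivMod using (_/ℕ_; _%ℕ_; a≡a%ℕn+[a/ℕn]*n; n%ℕd<d; [n/ℕd]*d≤n; n<s[n/ℕd]*d; div-pos-is-/ℕ)
import Data.Integer.Divisibility.Signed as ℤ∣
import Data.Integer.GCD as ℤGCD
open import Data.Integer.Tactic.RingSolver using (solve; solve-∀)
open import Data.Rational as ℚ using (mkℚ; ↥_; ↧_; ↧ₙ_; floor; toℚᵘ)
import Data.Rational.Properties as ℚP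
open import Data.Rational.Unnormalised as ℚᵘ using (mkℚᵘ; *≡*; *≤*) renaming (_≃_ to _≃ᵘ_)
import Data.Rational.Unnormalised.Properties as ℚᵘP
open import Data.Fin as Fin using (Fin; toℕ; fromℕ<)
import Data.Fin.Properties as FinP
open import Data.Fin.Permutation using (permutation)
import Algebra.Properties.CommutativeMonoid.Sum as CommutativeMonoidSum
open import Algebra.Bundles using (AbelianGroup; CommutativeMonoid)
open import Algebra.Properties.Group (AbelianGroup.group ℤP.+-0-abelianGroup) using (∙-cancelʳ)
open import Algebra.Properties.CommutativeSemigroup ℤP.+-commutativeSemigroup
  using () renaming (interchange to +-interchange)
open import Algebra.Properties.CommutativeSemigroup (CommutativeMonoid.commutativeSemigroup ℚP.*-1-commutativeMonoid)
  using () renaming (interchange to *-interchange)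
open import Data.Product using (∃; _,_; proj₁; proj₂)
open import Data.Sum using (inj₁; inj₂)
open import Data.Empty using (⊥-elim)
open import Data.List using (_∷_; [])
open import Function using (_∘′_)
open import Function.Bundles using (_⇔_; mk⇔; Equivalence)
open import Function.Definitions using (Injective)
open import Relation.Nullary using (Dec; yes; no; contradiction)
open import Relation.Binary.PropositionalEquality

-- Put k = c₁, u = (-a⁻¹t) mod c and G(a, n, u) = Σ_{m<n} m·((a m + u) mod n) (residueMoment).
-- The first factor of the m-th summand of σ is ((k m + u) mod c)/c - 1/2, and m ↦ (k m + u) mod c
-- permutes the residues, so 4c²·σ = 4 G(k, c, u) - c³ + 2c².  Counting the lattice points under
-- the line m ↦ (a m + u)/n in two ways gives the reciprocity law
--   12a²·G(a, n, u) + 12n²·G(n mod a, a, u mod a) = P(a, n, u)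
-- for an explicit polynomial P.  It is applied to (k, c) and, in cases (ii) and (iii), once more
-- to (c₂, k).  The last G is 0 when its modulus is 1, and otherwise it is bounded below by
-- expanding Σ_{i<l} (l - i - s i)² ≥ 0, where s permutes the residues mod l.  Each bound thereby
-- becomes an inequality between integer polynomials, proved by an explicit nonnegative
-- certificate.  In case (iii) this gives σ ≥ bound - q with q the second factor of the radicand,
-- and q ≤ √radicand because 0 ≤ q ≤ first factor.

linear-combination : ∀ {x y lhs rhs : ℤ} (c : ℤ) → x ≡ y → lhs ≡ rhs + c * (x - y) → lhs ≡ rhs
linear-combination {x} {rhs = rhs} c refl eq
  rewrite ℤP.+-inverseʳ x | ℤP.*-zeroʳ c | ℤP.+-identityʳ rhs = eq

≤-from-gap : ∀ {x y} z → 0ℤ ≤ℤ z → y ≡ x + z → x ≤ℤ y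
≤-from-gap {x} z 0≤z refl = ℤP.i≤i+j x z {{ℤ.nonNegative 0≤z}}

0≤+ : ∀ n → 0ℤ ≤ℤ + n
0≤+ n = +≤+ z≤n

0≤i*i : ∀ i → 0ℤ ≤ℤ i * i
0≤i*i (+ n)      = subst (0ℤ ≤ℤ_) (ℤP.pos-* n n) (0≤+ (n ℕ.* n))
0≤i*i ℤ.-[1+ n ] = 0≤+ _

infixl 7 _⟨*⟩_
infixl 6 _⟨+⟩_

_⟨*⟩_ : ∀ {i j} → 0ℤ ≤ℤ i → 0ℤ ≤ℤ j → 0ℤ ≤ℤ i * j
_⟨*⟩_ {i} {j} 0≤i 0≤j = subst (_≤ℤ i * j) (ℤP.*-zeroˡ j) (ℤP.*-monoʳ-≤-nonNeg j {{ℤ.nonNegative 0≤j}} 0≤i)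

_⟨+⟩_ : ∀ {i j} → 0ℤ ≤ℤ i → 0ℤ ≤ℤ j → 0ℤ ≤ℤ i + j
_⟨+⟩_ = ℤP.+-mono-≤

pos-∸ : ∀ {m n} → n ≤ m → + (m ℕ.∸ n) ≡ + m - + n
pos-∸ {m} {n} n≤m = sym (trans (ℤP.m-n≡m⊖n m n) (ℤP.⊖-≥ n≤m))

pos-*-+ : ∀ a b c → + (a ℕ.* b ℕ.+ c) ≡ + a * + b + + c
pos-*-+ a b c = trans (ℤP.pos-+ (a ℕ.* b) c) (cong (_+ + c) (ℤP.pos-* a b))

-- Finite sums

∑ : ℕ → (ℕ → ℤ) → ℤ
∑ zero    f = 0ℤ
∑ (suc n) f = ∑ n f + f n

syntax ∑ n (λ m → e) = ∑[ m < n ] e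

∑-cong : ∀ n {f g : ℕ → ℤ} → (∀ m → m < n → f m ≡ g m) → ∑ n f ≡ ∑ n g
∑-cong zero    eq = refl
∑-cong (suc n) eq = cong₂ _+_ (∑-cong n (λ m m<n → eq m (ℕP.m<n⇒m<1+n m<n))) (eq n ℕP.≤-refl)

∑-distrib-+ : ∀ n (f g : ℕ → ℤ) → ∑[ m < n ] (f m + g m) ≡ ∑ n f + ∑ n g
∑-distrib-+ zero    f g = refl
∑-distrib-+ (suc n) f g rewrite ∑-distrib-+ n f g = +-interchange (∑ n f) (∑ n g) (f n) (g n)

∑-distribˡ-* : ∀ n (c : ℤ) (f : ℕ → ℤ) → ∑[ m < n ] (c * f m) ≡ c * ∑ n f
∑-distribˡ-* zero    c f = sym (ℤP.*-zeroʳ c)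
∑-distribˡ-* (suc n) c f rewrite ∑-distribˡ-* n c f = sym (ℤP.*-distribˡ-+ c (∑ n f) (f n))

∑-zero : ∀ n → ∑[ m < n ] 0ℤ ≡ 0ℤ
∑-zero zero    = refl
∑-zero (suc n) = cong (_+ 0ℤ) (∑-zero n)

∑-comm : ∀ m n (f : ℕ → ℕ → ℤ) → ∑[ i < m ] ∑[ j < n ] f i j ≡ ∑[ j < n ] ∑[ i < m ] f i j
∑-comm zero    n f = sym (∑-zero n)
∑-comm (suc m) n f rewrite ∑-comm m n f = sym (∑-distrib-+ n (λ j → ∑[ i < m ] f i j) (f m))

∑-head : ∀ n (f : ℕ → ℤ) → ∑ (suc n) f ≡ f 0 + ∑[ m < n ] f (suc m)
∑-head zero    f = ℤP.+-comm 0ℤ (f 0)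
∑-head (suc n) f rewrite ∑-head n f = ℤP.+-assoc (f 0) _ _

∑-reverse : ∀ n (f : ℕ → ℤ) → ∑[ m < n ] f (n ℕ.∸ suc m) ≡ ∑ n f
∑-reverse zero    f = refl
∑-reverse (suc n) f = begin
  ∑[ m < suc n ] f (n ℕ.∸ m)         ≡⟨ ∑-head n _ ⟩
  f n + ∑[ m < n ] f (n ℕ.∸ suc m)   ≡⟨ cong (λ s → f n + s) (∑-reverse n f) ⟩
  f n + ∑ n f                        ≡⟨ ℤP.+-comm (f n) (∑ n f) ⟩
  ∑ (suc n) f                        ∎
  where open ≡-Reasoning

∑-nonNeg : ∀ n {f : ℕ → ℤ} → (∀ m → 0ℤ ≤ℤ f m) → 0ℤ ≤ℤ ∑ n f
∑-nonNeg zero    f≥0 = ℤP.≤-refl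
∑-nonNeg (suc n) f≥0 = ∑-nonNeg n f≥0 ⟨+⟩ f≥0 n

2*∑i≡n*[n-1] : ∀ n → + 2 * ∑[ i < n ] (+ i) ≡ + n * (+ n - 1ℤ)
2*∑i≡n*[n-1] zero    = refl
2*∑i≡n*[n-1] (suc n) = begin
  + 2 * (∑[ i < n ] (+ i) + + n)       ≡⟨ ℤP.*-distribˡ-+ (+ 2) (∑[ i < n ] (+ i)) (+ n) ⟩
  + 2 * ∑[ i < n ] (+ i) + + 2 * + n   ≡⟨ cong (_+ + 2 * + n) (2*∑i≡n*[n-1] n) ⟩
  + n * (+ n - 1ℤ) + + 2 * + n         ≡⟨ step (+ n) ⟩
  (1ℤ + + n) * (1ℤ + + n - 1ℤ)         ∎
  where
  open ≡-Reasoning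
  step : ∀ x → x * (x - 1ℤ) + + 2 * x ≡ (1ℤ + x) * (1ℤ + x - 1ℤ)
  step = solve-∀

6*∑i²≡n*[n-1]*[2n-1] : ∀ n → + 6 * ∑[ i < n ] (+ i * + i) ≡ + n * (+ n - 1ℤ) * (+ 2 * + n - 1ℤ)
6*∑i²≡n*[n-1]*[2n-1] zero    = refl
6*∑i²≡n*[n-1]*[2n-1] (suc n) = begin
  + 6 * (∑[ i < n ] (+ i * + i) + + n * + n)               ≡⟨ ℤP.*-distribˡ-+ (+ 6) (∑[ i < n ] (+ i * + i)) (+ n * + n) ⟩
  + 6 * ∑[ i < n ] (+ i * + i) + + 6 * (+ n * + n)         ≡⟨ cong (_+ + 6 * (+ n * + n)) (6*∑i²≡n*[n-1]*[2n-1] n) ⟩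
  + n * (+ n - 1ℤ) * (+ 2 * + n - 1ℤ) + + 6 * (+ n * + n)  ≡⟨ step (+ n) ⟩
  (1ℤ + + n) * (1ℤ + + n - 1ℤ) * (+ 2 * (1ℤ + + n) - 1ℤ)   ∎
  where
  open ≡-Reasoning
  step : ∀ x → x * (x - 1ℤ) * (+ 2 * x - 1ℤ) + + 6 * (x * x) ≡ (1ℤ + x) * (1ℤ + x - 1ℤ) * (+ 2 * (1ℤ + x) - 1ℤ)
  step = solve-∀

∑-quadratic : ∀ n (s : ℕ → ℤ) (α β γ δ ε ζ : ℤ) →
  ∑[ i < n ] (α + β * + i + γ * s i + δ * (+ i * + i) + ε * (s i * s i) + ζ * (+ i * s i)) ≡
  α * + n + β * ∑[ i < n ] (+ i) + γ * ∑ n s + δ * ∑[ i < n ] (+ i * + i) + ε * ∑[ i < n ] (s i * s i)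
    + ζ * ∑[ i < n ] (+ i * s i)
∑-quadratic zero    s α β γ δ ε ζ = solve (α ∷ β ∷ γ ∷ δ ∷ ε ∷ ζ ∷ [])
∑-quadratic (suc n) s α β γ δ ε ζ rewrite ∑-quadratic n s α β γ δ ε ζ | ℤP.pos-+ 1 n =
  step (+ n) (s n) (∑[ i < n ] (+ i)) (∑ n s) (∑[ i < n ] (+ i * + i)) (∑[ i < n ] (s i * s i))
    (∑[ i < n ] (+ i * s i))
  where
  step : ∀ x y S₁ Sₛ S₂ Sₛₛ Sₓₛ →
    α * x + β * S₁ + γ * Sₛ + δ * S₂ + ε * Sₛₛ + ζ * Sₓₛ
      + (α + β * x + γ * y + δ * (x * x) + ε * (y * y) + ζ * (x * y)) ≡
    α * (1ℤ + x) + β * (S₁ + x) + γ * (Sₛ + y) + δ * (S₂ + x * x) + ε * (Sₛₛ + y * y) + ζ * (Sₓₛ + x * y)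
  step x y S₁ Sₛ S₂ Sₛₛ Sₓₛ = solve (x ∷ y ∷ S₁ ∷ Sₛ ∷ S₂ ∷ Sₛₛ ∷ Sₓₛ ∷ α ∷ β ∷ γ ∷ δ ∷ ε ∷ ζ ∷ [])

-- Permutations of residues

module FinSum = CommutativeMonoidSum ℤP.+-0-commutativeMonoid

∑≡Fin-sum : ∀ n (f : ℕ → ℤ) → ∑ n f ≡ FinSum.sum (λ (i : Fin n) → f (toℕ i))
∑≡Fin-sum zero    f = refl
∑≡Fin-sum (suc n) f = trans (∑-head n f) (cong (λ s → f 0 + s) (∑≡Fin-sum n (f ∘′ suc)))

injective⇒surjective : ∀ {n} {π : Fin n → Fin n} → Injective _≡_ _≡_ π → ∀ j → ∃ λ i → π i ≡ j
injective⇒surjective {suc m} {π} π-inj j with FinP.any? (λ i → π i Fin.≟ j)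
... | yes hit = hit
... | no miss = contradiction (FinP.injective⇒≤ π′-inj) (ℕP.<-irrefl refl)
  where
  π′ : Fin (suc m) → Fin m
  π′ i = Fin.punchOut {i = j} (λ eq → miss (i , sym eq))
  π′-inj : Injective _≡_ _≡_ π′
  π′-inj {x} {y} eq = π-inj (FinP.punchOut-injective {i = j} (λ e → miss (x , sym e)) (λ e → miss (y , sym e)) eq)

record IsPermutation (n : ℕ) (π : ℕ → ℕ) : Set where
  field
    bounded   : ∀ {i} → i < n → π i < n
    injective : ∀ {i j} → i < n → j < n → π i ≡ π j → i ≡ j

∑-permute : ∀ {n π} → IsPermutation n π → (g : ℕ → ℤ) → ∑[ i < n ] g (π i) ≡ ∑ n g
∑-permute {n} {π} perm g = begin
  ∑[ i < n ] g (π i)                     ≡⟨ ∑≡Fin-sum n (g ∘′ π) ⟩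
  FinSum.sum {n} (λ i → g (π (toℕ i)))   ≡⟨ FinSum.sum-cong-≗ (λ i → cong g (toℕ-π̂ i)) ⟨
  FinSum.sum {n} (λ i → g (toℕ (π̂ i)))   ≡⟨ FinSum.sum-permute (λ i → g (toℕ i)) π̂-permutation ⟨
  FinSum.sum {n} (λ i → g (toℕ i))       ≡⟨ ∑≡Fin-sum n g ⟨
  ∑ n g                                  ∎
  where
  open ≡-Reasoning
  open IsPermutation perm
  π̂ : Fin n → Fin n
  π̂ i = fromℕ< (bounded (FinP.toℕ<n i))
  toℕ-π̂ : ∀ i → toℕ (π̂ i) ≡ π (toℕ i)
  toℕ-π̂ i = FinP.toℕ-fromℕ< (bounded (FinP.toℕ<n i))
  π̂-inj : Injective _≡_ _≡_ π̂
  π̂-inj {i} {j} eq = FinP.toℕ-injective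
    (injective (FinP.toℕ<n i) (FinP.toℕ<n j) (trans (sym (toℕ-π̂ i)) (trans (cong toℕ eq) (toℕ-π̂ j))))
  π̂-permutation = permutation π̂ (λ j → proj₁ (injective⇒surjective π̂-inj j))
                                 (λ j → proj₂ (injective⇒surjective π̂-inj j))
                                 (λ i → π̂-inj (proj₂ (injective⇒surjective π̂-inj (π̂ i))))

[m+n]%d≡m%d⇒d∣n : ∀ m n d .{{_ : NonZero d}} → (m ℕ.+ n) % d ≡ m % d → d ℕ∣.∣ n
[m+n]%d≡m%d⇒d∣n m n d eq = ℕ∣.∣m+n∣m⇒∣n (ℕ∣.divides ((m ℕ.+ n) / d) (ℕP.+-cancelˡ-≡ (m % d) _ _ (begin
  m % d ℕ.+ (m / d ℕ.* d ℕ.+ n)           ≡⟨ ℕP.+-assoc (m % d) _ n ⟨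
  m % d ℕ.+ m / d ℕ.* d ℕ.+ n             ≡⟨ cong (ℕ._+ n) (m≡m%n+[m/n]*n m d) ⟨
  m ℕ.+ n                                 ≡⟨ m≡m%n+[m/n]*n (m ℕ.+ n) d ⟩
  (m ℕ.+ n) % d ℕ.+ (m ℕ.+ n) / d ℕ.* d   ≡⟨ cong (ℕ._+ (m ℕ.+ n) / d ℕ.* d) eq ⟩
  m % d ℕ.+ (m ℕ.+ n) / d ℕ.* d           ∎))) (ℕ∣.n∣m*n (m / d))
  where open ≡-Reasoning

affine-isPermutation : ∀ {a n} u .{{_ : NonZero n}} → Coprime a n → IsPermutation n (λ i → (a ℕ.* i ℕ.+ u) % n)
affine-isPermutation {a} {n} u a⊥n = record { bounded = λ _ → m%n<n _ n ; injective = injective }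
  where
  injective-≤ : ∀ {i j} → j ≤ i → i < n → (a ℕ.* i ℕ.+ u) % n ≡ (a ℕ.* j ℕ.+ u) % n → i ≡ j
  injective-≤ {i} {j} j≤i i<n eq = begin
    i          ≡⟨ ℕP.m+[n∸m]≡n j≤i ⟨
    j ℕ.+ d    ≡⟨ cong (j ℕ.+_) d≡0 ⟩
    j ℕ.+ 0    ≡⟨ ℕP.+-identityʳ j ⟩
    j          ∎
    where
    open ≡-Reasoning
    d = i ℕ.∸ j
    distribute : ∀ a j d u → a ℕ.* (j ℕ.+ d) ℕ.+ u ≡ (a ℕ.* j ℕ.+ u) ℕ.+ a ℕ.* d
    distribute = ℕSolver.solve-∀
    shift : a ℕ.* i ℕ.+ u ≡ (a ℕ.* j ℕ.+ u) ℕ.+ a ℕ.* d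
    shift = trans (cong (λ x → a ℕ.* x ℕ.+ u) (sym (ℕP.m+[n∸m]≡n j≤i))) (distribute a j d u)
    n∣d : n ℕ∣.∣ d
    n∣d = coprime-divisor (Coprimality.sym a⊥n)
      ([m+n]%d≡m%d⇒d∣n (a ℕ.* j ℕ.+ u) (a ℕ.* d) n (trans (cong (_% n) (sym shift)) eq))
    d≡0 : d ≡ 0
    d≡0 with d | n∣d | ℕP.≤-<-trans (ℕP.m∸n≤m i j) i<n
    ... | zero  | _   | _   = refl
    ... | suc _ | n∣d | d<n = ⊥-elim (ℕP.<-irrefl refl (ℕP.≤-<-trans (ℕ∣.∣⇒≤ n∣d) d<n))
  injective : ∀ {i j} → i < n → j < n → (a ℕ.* i ℕ.+ u) % n ≡ (a ℕ.* j ℕ.+ u) % n → i ≡ j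
  injective {i} {j} i<n j<n eq with ℕP.≤-total j i
  ... | inj₁ j≤i = injective-≤ j≤i i<n eq
  ... | inj₂ i≤j = sym (injective-≤ i≤j j<n (sym eq))

∑-quadratic-permutation : ∀ {n π} → IsPermutation n π → ∀ (α β γ δ ε ζ : ℤ) →
  + 6 * ∑[ i < n ] (α + β * + i + γ * + π i + δ * (+ i * + i) + ε * (+ π i * + π i) + ζ * (+ i * + π i)) ≡
  + 6 * α * + n + + 3 * (β + γ) * (+ n * (+ n - 1ℤ)) + (δ + ε) * (+ n * (+ n - 1ℤ) * (+ 2 * + n - 1ℤ))
    + + 6 * ζ * ∑[ i < n ] (+ i * + π i)
∑-quadratic-permutation {n} {π} perm α β γ δ ε ζ
  rewrite ∑-quadratic n (λ i → + π i) α β γ δ ε ζ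
        | ∑-permute perm (λ m → + m)
        | ∑-permute perm (λ m → + m * + m)
  = collect (+ n) (∑[ i < n ] (+ i)) (∑[ i < n ] (+ i * + i)) (∑[ i < n ] (+ i * + π i))
            (2*∑i≡n*[n-1] n) (6*∑i²≡n*[n-1]*[2n-1] n)
  where
  collect : ∀ N S₁ S₂ X → + 2 * S₁ ≡ N * (N - 1ℤ) → + 6 * S₂ ≡ N * (N - 1ℤ) * (+ 2 * N - 1ℤ) →
    + 6 * (α * N + β * S₁ + γ * S₁ + δ * S₂ + ε * S₂ + ζ * X) ≡
    + 6 * α * N + + 3 * (β + γ) * (N * (N - 1ℤ)) + (δ + ε) * (N * (N - 1ℤ) * (+ 2 * N - 1ℤ)) + + 6 * ζ * X
  collect N S₁ S₂ X h₁ h₂ = linear-combination (+ 3 * (β + γ)) h₁ (linear-combination (δ + ε) h₂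
    (solve (N ∷ S₁ ∷ S₂ ∷ X ∷ α ∷ β ∷ γ ∷ δ ∷ ε ∷ ζ ∷ [])))

-- Division with remainder

<1+⇒≤ : ∀ {i j} → i <ℤ 1ℤ + j → i ≤ℤ j
<1+⇒≤ {i} {j} i<1+j = subst (i ≤ℤ_) (ℤP.pred-suc j) (ℤP.i<j⇒i≤pred[j] i<1+j)

/ℕ-unique : ∀ {x} q d .{{_ : NonZero d}} → q * + d ≤ℤ x → x <ℤ (1ℤ + q) * + d → x /ℕ d ≡ q
/ℕ-unique {x} q d q*d≤x x<[1+q]*d = ℤP.≤-antisym
  (<1+⇒≤ (ℤP.*-cancelʳ-<-nonNeg (+ d) (ℤP.≤-<-trans ([n/ℕd]*d≤n x d) x<[1+q]*d)))
  (<1+⇒≤ (ℤP.*-cancelʳ-<-nonNeg (+ d) (ℤP.≤-<-trans q*d≤x (n<s[n/ℕd]*d x d))))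

%ℕ-unique : ∀ {x r} q d .{{_ : NonZero d}} → r < d → x ≡ + r + q * + d → x %ℕ d ≡ r
%ℕ-unique {x} {r} q d r<d refl =
  ℤP.+-injective (∙-cancelʳ (x /ℕ d * + d) (+ (x %ℕ d)) (+ r) (begin
  + (x %ℕ d) + x /ℕ d * + d   ≡⟨ a≡a%ℕn+[a/ℕn]*n x d ⟨
  x                           ≡⟨ cong (λ y → + r + y * + d) (/ℕ-unique q d q*d≤x x<[1+q]*d) ⟨
  + r + x /ℕ d * + d          ∎))
  where
  open ≡-Reasoning
  q*d≤x : q * + d ≤ℤ + r + q * + d
  q*d≤x = ℤP.i≤j+i (q * + d) (+ r)
  x<[1+q]*d : + r + q * + d <ℤ (1ℤ + q) * + d
  x<[1+q]*d = subst (+ r + q * + d <ℤ_) (sym (ℤP.suc-* q (+ d))) (ℤP.+-monoˡ-< (q * + d) (+<+ r<d))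

%ℕ-affine : ∀ X Y m d .{{_ : NonZero d}} → (X * + m + Y) %ℕ d ≡ ((X %ℕ d) ℕ.* m ℕ.+ Y %ℕ d) % d
%ℕ-affine X Y m d = %ℕ-unique (+ q + X /ℕ d * + m + Y /ℕ d) d (m%n<n (k ℕ.* m ℕ.+ u) d)
  (recombine X Y (+ m) (+ d) (+ k) (+ u) (+ r) (X /ℕ d) (Y /ℕ d) (+ q) (a≡a%ℕn+[a/ℕn]*n X d) (a≡a%ℕn+[a/ℕn]*n Y d) k*m+u≡)
  where
  k u r q : ℕ
  k = X %ℕ d
  u = Y %ℕ d
  r = (k ℕ.* m ℕ.+ u) % d
  q = (k ℕ.* m ℕ.+ u) / d
  k*m+u≡ : + k * + m + + u ≡ + r + + q * + d
  k*m+u≡ = trans (sym (pos-*-+ k m u)) (a≡a%ℕn+[a/ℕn]*n (+ (k ℕ.* m ℕ.+ u)) d)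
  recombine : ∀ X Y M D K U R Q₁ Q₂ Q → X ≡ K + Q₁ * D → Y ≡ U + Q₂ * D → K * M + U ≡ R + Q * D →
    X * M + Y ≡ R + (Q + Q₁ * M + Q₂) * D
  recombine X Y M D K U R Q₁ Q₂ Q hX hY h =
    linear-combination M hX (linear-combination 1ℤ hY (linear-combination 1ℤ h
      (solve (X ∷ Y ∷ M ∷ D ∷ K ∷ U ∷ R ∷ Q₁ ∷ Q₂ ∷ Q ∷ []))))

[n*i+u]%a≡[[n%a]*i+u%a]%a : ∀ n i u a .{{_ : NonZero a}} →
  (n ℕ.* i ℕ.+ u) % a ≡ ((n % a) ℕ.* i ℕ.+ u % a) % a
[n*i+u]%a≡[[n%a]*i+u%a]%a n i u a = trans (cong (_%ℕ a) (pos-*-+ n i u)) (%ℕ-affine (+ n) (+ u) i a)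

modℕ≡% : ∀ m n .{{_ : NonZero n}} → m modℕ n ≡ m % n
modℕ≡% m (suc n) = refl

coprime-% : ∀ {m n} .{{_ : NonZero n}} → Coprime m n → Coprime (m % n) n
coprime-% m⊥n (d∣m%n , d∣n) = m⊥n (ℕ∣.∣n∣m%n⇒∣m d∣n d∣m%n , d∣n)

-- The residue moment and its reciprocity law

residueMoment : (a n u : ℕ) .{{_ : NonZero n}} → ℤ
residueMoment a n u = ∑[ m < n ] (+ m * + ((a ℕ.* m ℕ.+ u) % n))

𝟙 : ∀ {p} {P : Set p} → Dec P → ℤ
𝟙 (yes _) = 1ℤ
𝟙 (no _)  = 0ℤ

𝟙-cong : ∀ {p q} {P : Set p} {Q : Set q} (P? : Dec P) (Q? : Dec Q) → P ⇔ Q → 𝟙 P? ≡ 𝟙 Q?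
𝟙-cong (yes _) (yes _) _   = refl
𝟙-cong (yes p) (no ¬q) P⇔Q = contradiction (Equivalence.to P⇔Q p) ¬q
𝟙-cong (no ¬p) (yes q) P⇔Q = contradiction (Equivalence.from P⇔Q q) ¬p
𝟙-cong (no _)  (no _)  _   = refl

∑𝟙[j<y]≡A⊓y : ∀ A y → ∑[ j < A ] 𝟙 (j ℕ.<? y) ≡ + (A ⊓ y)
∑𝟙[j<y]≡A⊓y zero    y = refl
∑𝟙[j<y]≡A⊓y (suc A) y with A ℕ.<? y
... | yes A<y rewrite ∑𝟙[j<y]≡A⊓y A y | ℕP.m≤n⇒m⊓n≡m (ℕP.<⇒≤ A<y) | ℕP.m≤n⇒m⊓n≡m A<y = ℤP.+-comm (+ A) 1ℤ
... | no  A≮y rewrite ∑𝟙[j<y]≡A⊓y A y | ℕP.m≥n⇒m⊓n≡n (ℕP.≮⇒≥ A≮y) | ℕP.m≥n⇒m⊓n≡n (ℕP.m≤n⇒m≤1+n (ℕP.≮⇒≥ A≮y)) =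
  ℤP.+-identityʳ (+ y)

m≤o/n⇔n*m≤o : ∀ {m o} n .{{_ : NonZero n}} → m ≤ o / n ⇔ n ℕ.* m ≤ o
m≤o/n⇔n*m≤o {m} {o} n = mk⇔
  (λ m≤o/n → ℕP.≤-trans (subst (_≤ o / n ℕ.* n) (ℕP.*-comm m n) (ℕP.*-monoˡ-≤ n m≤o/n)) (m/n*n≤m o n))
  (λ nm≤o → subst (_≤ o / n) (m*n/n≡m m n) (/-monoˡ-≤ n (subst (_≤ o) (ℕP.*-comm n m) nm≤o)))

quotient-as-count : ∀ {n} .{{_ : NonZero n}} x A → x / n ≤ A → + (x / n) ≡ ∑[ j < A ] 𝟙 (n ℕ.* suc j ℕ.≤? x)
quotient-as-count {n} x A x/n≤A = begin
  + (x / n)                           ≡⟨ cong +_ (ℕP.m≥n⇒m⊓n≡n x/n≤A) ⟨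
  + (A ⊓ (x / n))                     ≡⟨ ∑𝟙[j<y]≡A⊓y A (x / n) ⟨
  ∑[ j < A ] 𝟙 (j ℕ.<? x / n)         ≡⟨ ∑-cong A (λ j _ → 𝟙-cong _ _ (m≤o/n⇔n*m≤o n)) ⟩
  ∑[ j < A ] 𝟙 (n ℕ.* suc j ℕ.≤? x)   ∎
  where open ≡-Reasoning

2*∑m𝟙[e≤m] : ∀ {e} n → e ≤ n → + 2 * ∑[ m < n ] (+ m * 𝟙 (e ℕ.≤? m)) ≡ + n * (+ n - 1ℤ) - + e * (+ e - 1ℤ)
2*∑m𝟙[e≤m] zero    z≤n = refl
2*∑m𝟙[e≤m] {e} (suc n) e≤1+n with e ℕ.≤? n
... | yes e≤n = begin
  + 2 * (S + + n * 1ℤ)                                    ≡⟨ ℤP.*-distribˡ-+ (+ 2) S (+ n * 1ℤ) ⟩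
  + 2 * S + + 2 * (+ n * 1ℤ)                              ≡⟨ cong (_+ + 2 * (+ n * 1ℤ)) (2*∑m𝟙[e≤m] n e≤n) ⟩
  + n * (+ n - 1ℤ) - + e * (+ e - 1ℤ) + + 2 * (+ n * 1ℤ)  ≡⟨ step (+ n) (+ e) ⟩
  (1ℤ + + n) * (1ℤ + + n - 1ℤ) - + e * (+ e - 1ℤ)        ∎
  where
  open ≡-Reasoning
  S = ∑[ m < n ] (+ m * 𝟙 (e ℕ.≤? m))
  step : ∀ x y → x * (x - 1ℤ) - y * (y - 1ℤ) + + 2 * (x * 1ℤ) ≡ (1ℤ + x) * (1ℤ + x - 1ℤ) - y * (y - 1ℤ)
  step = solve-∀
... | no e≰n rewrite ℕP.≤-antisym e≤1+n (ℕP.≰⇒> e≰n) = begin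
  + 2 * (∑[ m < n ] (+ m * 𝟙 (suc n ℕ.≤? m)) + + n * 0ℤ)   ≡⟨ cong (λ S → + 2 * (S + + n * 0ℤ)) (trans (∑-cong n vanish) (∑-zero n)) ⟩
  + 2 * (0ℤ + + n * 0ℤ)                                    ≡⟨ step (+ n) ⟩
  + suc n * (+ suc n - 1ℤ) - + suc n * (+ suc n - 1ℤ)      ∎
  where
  open ≡-Reasoning
  vanish : ∀ m → m < n → + m * 𝟙 (suc n ℕ.≤? m) ≡ 0ℤ
  vanish m m<n with suc n ℕ.≤? m
  ... | yes n<m = contradiction (ℕP.<-trans m<n n<m) (ℕP.<-irrefl refl)
  ... | no  _   = ℤP.*-zeroʳ (+ m)
  step : ∀ x → + 2 * (0ℤ + x * 0ℤ) ≡ (1ℤ + x) * (1ℤ + x - 1ℤ) - (1ℤ + x) * (1ℤ + x - 1ℤ)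
  step = solve-∀

threshold : ∀ {a e u N s} m → s < a → a ℕ.* e ℕ.+ u ≡ N ℕ.+ s → N ≤ a ℕ.* m ℕ.+ u ⇔ e ≤ m
threshold {a} {e} {u} {N} {s} m s<a key = mk⇔ to from
  where
  open ℕP.≤-Reasoning
  rearrange : ∀ a m u → a ℕ.* m ℕ.+ u ℕ.+ a ≡ a ℕ.* suc m ℕ.+ u
  rearrange = ℕSolver.solve-∀
  to : N ≤ a ℕ.* m ℕ.+ u → e ≤ m
  to N≤am+u = ℕP.≤-pred (ℕP.*-cancelˡ-< a e (suc m) (ℕP.+-cancelʳ-< u (a ℕ.* e) (a ℕ.* suc m) (begin-strict
    a ℕ.* e ℕ.+ u          ≡⟨ key ⟩
    N ℕ.+ s                <⟨ ℕP.+-mono-≤-< N≤am+u s<a ⟩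
    a ℕ.* m ℕ.+ u ℕ.+ a    ≡⟨ rearrange a m u ⟩
    a ℕ.* suc m ℕ.+ u      ∎)))
  from : e ≤ m → N ≤ a ℕ.* m ℕ.+ u
  from e≤m = begin
    N                ≤⟨ ℕP.m≤m+n N s ⟩
    N ℕ.+ s          ≡⟨ key ⟨
    a ℕ.* e ℕ.+ u    ≤⟨ ℕP.+-monoˡ-≤ u (ℕP.*-monoʳ-≤ a e≤m) ⟩
    a ℕ.* m ℕ.+ u    ∎

n*i+u<n*a : ∀ {n i u a} → u < n → i < a → n ℕ.* i ℕ.+ u < n ℕ.* a
n*i+u<n*a {n} {i} {u} {a} u<n i<a = begin-strict
  n ℕ.* i ℕ.+ u   <⟨ ℕP.+-monoʳ-< (n ℕ.* i) u<n ⟩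
  n ℕ.* i ℕ.+ n   ≡⟨ trans (ℕP.+-comm (n ℕ.* i) n) (sym (ℕP.*-suc n i)) ⟩
  n ℕ.* suc i     ≤⟨ ℕP.*-monoʳ-≤ n i<a ⟩
  n ℕ.* a         ∎
  where open ℕP.≤-Reasoning

module Reciprocity (a n u : ℕ) .{{_ : NonZero a}} .{{_ : NonZero n}} where

  A N U : ℤ
  A = + a
  N = + n
  U = + u

  quotient : ℕ → ℕ
  quotient m = (a ℕ.* m ℕ.+ u) / n

  Q : ℤ
  Q = ∑[ m < n ] (+ m * + quotient m)

  residueMoment+N*Q : residueMoment a n u + N * Q ≡ A * ∑[ m < n ] (+ m * + m) + U * ∑[ m < n ] (+ m)
  residueMoment+N*Q = begin
    residueMoment a n u + N * Q                                             ≡⟨ cong (λ y → residueMoment a n u + y) (∑-distribˡ-* n N _) ⟨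
    residueMoment a n u + ∑[ m < n ] (N * (+ m * + quotient m))             ≡⟨ ∑-distrib-+ n _ _ ⟨
    ∑[ m < n ] (+ m * + ((a ℕ.* m ℕ.+ u) % n) + N * (+ m * + quotient m))   ≡⟨ ∑-cong n (λ m _ → pointwise m) ⟩
    ∑[ m < n ] (A * (+ m * + m) + U * + m)                                  ≡⟨ ∑-distrib-+ n _ _ ⟩
    ∑[ m < n ] (A * (+ m * + m)) + ∑[ m < n ] (U * + m)                     ≡⟨ cong₂ _+_ (∑-distribˡ-* n A _) (∑-distribˡ-* n U _) ⟩
    A * ∑[ m < n ] (+ m * + m) + U * ∑[ m < n ] (+ m)                       ∎
    where
    open ≡-Reasoning
    expand : ∀ M R Q A U N → A * M + U ≡ R + Q * N → M * R + N * (M * Q) ≡ A * (M * M) + U * M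
    expand M R Q A U N div = linear-combination (- M) div (solve (M ∷ R ∷ Q ∷ A ∷ U ∷ N ∷ []))
    pointwise : ∀ m → + m * + ((a ℕ.* m ℕ.+ u) % n) + N * (+ m * + quotient m) ≡ A * (+ m * + m) + U * + m
    pointwise m = expand (+ m) _ (+ quotient m) A U N
      (trans (sym (pos-*-+ a m u)) (a≡a%ℕn+[a/ℕn]*n (+ (a ℕ.* m ℕ.+ u)) n))

  T : ℕ → ℤ
  T i = ∑[ m < n ] (+ m * 𝟙 (n ℕ.* (a ℕ.∸ i) ℕ.≤? a ℕ.* m ℕ.+ u))

  quotient≤a : u < n → ∀ {m} → m < n → quotient m ≤ a
  quotient≤a u<n {m} m<n = ℕP.≤-pred (m<n*o⇒m/o<n (begin-strict
    a ℕ.* m ℕ.+ u   <⟨ ℕP.+-mono-≤-< (ℕP.*-monoʳ-≤ a (ℕP.<⇒≤ m<n)) u<n ⟩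
    a ℕ.* n ℕ.+ n   ≡⟨ ℕP.+-comm (a ℕ.* n) n ⟩
    suc a ℕ.* n     ∎))
    where open ℕP.≤-Reasoning

  -- Each quotient ⌊(a m + u)/n⌋ counts the j < a with n (j + 1) ≤ a m + u; summing over m first
  -- and substituting j = a - 1 - i groups the lattice points by the level n (a - i).
  Q≡∑T : u < n → Q ≡ ∑ a T
  Q≡∑T u<n = begin
    ∑[ m < n ] (+ m * + quotient m)                                    ≡⟨ ∑-cong n (λ m m<n → cong (+ m *_) (quotient-as-count _ a (quotient≤a u<n m<n))) ⟩
    ∑[ m < n ] (+ m * ∑[ j < a ] 𝟙 (n ℕ.* suc j ℕ.≤? a ℕ.* m ℕ.+ u))   ≡⟨ ∑-cong n (λ m _ → ∑-distribˡ-* a (+ m) _) ⟨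
    ∑[ m < n ] ∑[ j < a ] (+ m * 𝟙 (n ℕ.* suc j ℕ.≤? a ℕ.* m ℕ.+ u))   ≡⟨ ∑-comm n a _ ⟩
    ∑[ j < a ] ∑[ m < n ] (+ m * 𝟙 (n ℕ.* suc j ℕ.≤? a ℕ.* m ℕ.+ u))   ≡⟨ ∑-cong a (λ j j<a → cong T′ (ℕP.m∸[m∸n]≡n j<a)) ⟨
    ∑[ j < a ] T (a ℕ.∸ suc j)                                         ≡⟨ ∑-reverse a T ⟩
    ∑ a T                                                              ∎
    where
    open ≡-Reasoning
    T′ : ℕ → ℤ
    T′ k = ∑[ m < n ] (+ m * 𝟙 (n ℕ.* k ℕ.≤? a ℕ.* m ℕ.+ u))

  s : ℕ → ℕ
  s i = (n ℕ.* i ℕ.+ u) % a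

  e : ℕ → ℕ
  e i = n ℕ.∸ (n ℕ.* i ℕ.+ u) / a

  A*e+U≡N*[A-i]+s : ∀ {i} → u < n → i < a → A * + e i + U ≡ N * (A - + i) + + s i
  A*e+U≡N*[A-i]+s {i} u<n i<a = begin
    A * + e i + U            ≡⟨ cong (λ x → A * x + U) (pos-∸ Y≤n) ⟩
    A * (N - + Y) + U        ≡⟨ reduce A N U (+ i) (+ s i) (+ Y) (trans (sym (pos-*-+ n i u)) (a≡a%ℕn+[a/ℕn]*n (+ (n ℕ.* i ℕ.+ u)) a)) ⟩
    N * (A - + i) + + s i    ∎
    where
    open ≡-Reasoning
    Y = (n ℕ.* i ℕ.+ u) / a
    Y≤n : Y ≤ n
    Y≤n = ℕP.<⇒≤ (m<n*o⇒m/o<n (n*i+u<n*a u<n i<a))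
    reduce : ∀ A N U I S Y → N * I + U ≡ S + Y * A → A * (N - Y) + U ≡ N * (A - I) + S
    reduce A N U I S Y div = linear-combination 1ℤ div (solve (A ∷ N ∷ U ∷ I ∷ S ∷ Y ∷ []))

  a*e+u≡n*[a-i]+s : ∀ {i} → u < n → i < a → a ℕ.* e i ℕ.+ u ≡ n ℕ.* (a ℕ.∸ i) ℕ.+ s i
  a*e+u≡n*[a-i]+s {i} u<n i<a = ℤP.+-injective (begin
    + (a ℕ.* e i ℕ.+ u)           ≡⟨ pos-*-+ a (e i) u ⟩
    A * + e i + U                 ≡⟨ A*e+U≡N*[A-i]+s u<n i<a ⟩
    N * (A - + i) + + s i         ≡⟨ cong (λ x → N * x + + s i) (pos-∸ (ℕP.<⇒≤ i<a)) ⟨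
    N * + (a ℕ.∸ i) + + s i       ≡⟨ pos-*-+ n (a ℕ.∸ i) (s i) ⟨
    + (n ℕ.* (a ℕ.∸ i) ℕ.+ s i)   ∎)
    where open ≡-Reasoning

  X : ℕ → ℤ
  X i = N * (A - + i) - U + + s i

  -- By a*e+u≡n*[a-i]+s and threshold, T i is the tail Σ_{e i ≤ m < n} m.
  T-closed-form : ∀ {i} → u < n → i < a → + 2 * (A * A) * T i ≡ A * A * (N * (N - 1ℤ)) - X i * X i + A * X i
  T-closed-form {i} u<n i<a = begin
    + 2 * (A * A) * T i
      ≡⟨ cong (+ 2 * (A * A) *_) (∑-cong n (λ m _ → cong (+ m *_) (𝟙-cong _ _ (threshold m (m%n<n _ a) (a*e+u≡n*[a-i]+s u<n i<a))))) ⟩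
    + 2 * (A * A) * ∑[ m < n ] (+ m * 𝟙 (e i ℕ.≤? m))
      ≡⟨ regroup A _ ⟩
    A * A * (+ 2 * ∑[ m < n ] (+ m * 𝟙 (e i ℕ.≤? m)))
      ≡⟨ cong (A * A *_) (2*∑m𝟙[e≤m] n (ℕP.m∸n≤m n ((n ℕ.* i ℕ.+ u) / a))) ⟩
    A * A * (N * (N - 1ℤ) - + e i * (+ e i - 1ℤ))
      ≡⟨ expand A N (+ e i) ⟩
    A * A * (N * (N - 1ℤ)) - (A * + e i) * (A * + e i) + A * (A * + e i)
      ≡⟨ cong (λ x → A * A * (N * (N - 1ℤ)) - x * x + A * x) A*e≡X ⟩
    A * A * (N * (N - 1ℤ)) - X i * X i + A * X i
      ∎
    where
    open ≡-Reasoning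
    isolate : ∀ x U y S → x + U ≡ y + S → x ≡ y - U + S
    isolate x U y S eq = linear-combination 1ℤ eq (solve (x ∷ U ∷ y ∷ S ∷ []))
    A*e≡X : A * + e i ≡ X i
    A*e≡X = isolate (A * + e i) U (N * (A - + i)) (+ s i) (A*e+U≡N*[A-i]+s u<n i<a)
    regroup : ∀ A S → + 2 * (A * A) * S ≡ A * A * (+ 2 * S)
    regroup A S = solve (A ∷ S ∷ [])
    expand : ∀ A N E → A * A * (N * (N - 1ℤ) - E * (E - 1ℤ)) ≡ A * A * (N * (N - 1ℤ)) - (A * E) * (A * E) + A * (A * E)
    expand A N E = solve (A ∷ N ∷ E ∷ [])

  Q-closed-form : u < n → Coprime n a →
    + 12 * (A * A) * Q ≡
    A * (A * A - 1ℤ - N * N + + 9 * A * N - + 9 * A * A * N - + 3 * A * N * N + + 4 * A * A * N * N + + 6 * U * (A * N + N - 1ℤ - U))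
      + + 12 * N * residueMoment (n % a) a (u % a)
  Q-closed-form u<n n⊥a = begin
    + 12 * (A * A) * Q
      ≡⟨ cong (+ 12 * (A * A) *_) (Q≡∑T u<n) ⟩
    + 12 * (A * A) * ∑ a T
      ≡⟨ regroup (A * A) (∑ a T) ⟩
    + 6 * (+ 2 * (A * A) * ∑ a T)
      ≡⟨ cong (+ 6 *_) (∑-distribˡ-* a (+ 2 * (A * A)) T) ⟨
    + 6 * ∑[ i < a ] (+ 2 * (A * A) * T i)
      ≡⟨ cong (+ 6 *_) (∑-cong a (λ i i<a → trans (T-closed-form u<n i<a) (expand A N U (+ i) (+ s i)))) ⟩
    + 6 * ∑[ i < a ] (α + β * + i + γ * + s i + δ * (+ i * + i) + ε * (+ s i * + s i) + ζ * (+ i * + s i))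
      ≡⟨ ∑-quadratic-permutation (affine-isPermutation u n⊥a) α β γ δ ε ζ ⟩
    + 6 * α * A + + 3 * (β + γ) * (A * (A - 1ℤ)) + (δ + ε) * (A * (A - 1ℤ) * (+ 2 * A - 1ℤ)) + + 6 * ζ * ∑[ i < a ] (+ i * + s i)
      ≡⟨ cong (λ x → + 6 * α * A + + 3 * (β + γ) * (A * (A - 1ℤ)) + (δ + ε) * (A * (A - 1ℤ) * (+ 2 * A - 1ℤ)) + + 6 * ζ * x) ∑i*s≡G₂ ⟩
    + 6 * α * A + + 3 * (β + γ) * (A * (A - 1ℤ)) + (δ + ε) * (A * (A - 1ℤ) * (+ 2 * A - 1ℤ)) + + 6 * ζ * G₂
      ≡⟨ collect A N U G₂ ⟩
    A * (A * A - 1ℤ - N * N + + 9 * A * N - + 9 * A * A * N - + 3 * A * N * N + + 4 * A * A * N * N + + 6 * U * (A * N + N - 1ℤ - U))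
      + + 12 * N * G₂
      ∎
    where
    open ≡-Reasoning
    G₂ = residueMoment (n % a) a (u % a)
    w α β γ δ ε ζ : ℤ
    w = N * A - U
    α = A * A * (N * (N - 1ℤ)) - w * w + A * w
    β = + 2 * w * N - A * N
    γ = A - + 2 * w
    δ = - (N * N)
    ε = - 1ℤ
    ζ = + 2 * N
    ∑i*s≡G₂ : ∑[ i < a ] (+ i * + s i) ≡ G₂
    ∑i*s≡G₂ = ∑-cong a (λ i _ → cong (λ r → + i * + r) ([n*i+u]%a≡[[n%a]*i+u%a]%a n i u a))
    regroup : ∀ B S → + 12 * B * S ≡ + 6 * (+ 2 * B * S)
    regroup B S = solve (B ∷ S ∷ [])
    expand : ∀ A N U I S → let X = N * (A - I) - U + S; w = N * A - U in
      A * A * (N * (N - 1ℤ)) - X * X + A * X ≡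
      (A * A * (N * (N - 1ℤ)) - w * w + A * w) + (+ 2 * w * N - A * N) * I + (A - + 2 * w) * S
        + (- (N * N)) * (I * I) + (- 1ℤ) * (S * S) + (+ 2 * N) * (I * S)
    expand A N U I S = solve (A ∷ N ∷ U ∷ I ∷ S ∷ [])
    collect : ∀ A N U G → let w = N * A - U in
      + 6 * (A * A * (N * (N - 1ℤ)) - w * w + A * w) * A + + 3 * ((+ 2 * w * N - A * N) + (A - + 2 * w)) * (A * (A - 1ℤ))
        + ((- (N * N)) + (- 1ℤ)) * (A * (A - 1ℤ) * (+ 2 * A - 1ℤ)) + + 6 * (+ 2 * N) * G ≡
      A * (A * A - 1ℤ - N * N + + 9 * A * N - + 9 * A * A * N - + 3 * A * N * N + + 4 * A * A * N * N + + 6 * U * (A * N + N - 1ℤ - U))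
        + + 12 * N * G
    collect A N U G = solve (A ∷ N ∷ U ∷ G ∷ [])

reciprocity : ∀ {a n u} .{{_ : NonZero a}} .{{_ : NonZero n}} → u < n → Coprime a n →
  + 12 * (+ a * + a) * residueMoment a n u + + 12 * (+ n * + n) * residueMoment (n % a) a (u % a) ≡
  + a * + n * (+ a * + a + + n * + n + 1ℤ + + 3 * + a * + n * (+ a + + n - + 3)) - + 6 * + a * + n * + u * (+ a + + n - 1ℤ - + u)
reciprocity {a} {n} {u} u<n a⊥n =
  eliminate (+ a) (+ n) (+ u) _ Q _ _ _
    residueMoment+N*Q (2*∑i≡n*[n-1] n) (6*∑i²≡n*[n-1]*[2n-1] n) (Q-closed-form u<n (Coprimality.sym a⊥n))
  where
  open Reciprocity a n u
  eliminate : ∀ A N U G Q G₂ S₁ S₂ →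
    G + N * Q ≡ A * S₂ + U * S₁ → + 2 * S₁ ≡ N * (N - 1ℤ) → + 6 * S₂ ≡ N * (N - 1ℤ) * (+ 2 * N - 1ℤ) →
    + 12 * (A * A) * Q ≡
      A * (A * A - 1ℤ - N * N + + 9 * A * N - + 9 * A * A * N - + 3 * A * N * N + + 4 * A * A * N * N + + 6 * U * (A * N + N - 1ℤ - U))
      + + 12 * N * G₂ →
    + 12 * (A * A) * G + + 12 * (N * N) * G₂ ≡
      A * N * (A * A + N * N + 1ℤ + + 3 * A * N * (A + N - + 3)) - + 6 * A * N * U * (A + N - 1ℤ - U)
  eliminate A N U G Q G₂ S₁ S₂ h₀ h₁ h₂ h₃ =
    linear-combination (+ 12 * (A * A)) h₀ (linear-combination (+ 6 * (A * A) * U) h₁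
      (linear-combination (+ 2 * (A * A * A)) h₂ (linear-combination (- N) h₃
        (solve (A ∷ N ∷ U ∷ G ∷ Q ∷ G₂ ∷ S₁ ∷ S₂ ∷ [])))))

-- Expand 0 ≤ Σ_{i<a} (a - i - s i)², using Σ s i = Σ i and Σ (s i)² = Σ i².
residueMoment-lower-bound : ∀ {b a} v .{{_ : NonZero a}} → Coprime b a →
  + a * (+ a * + a - + 3 * + a - 1ℤ) ≤ℤ + 6 * residueMoment b a v
residueMoment-lower-bound {b} {a} v b⊥a = ℤP.*-cancelˡ-≤-pos _ _ (+ 2)
  (≤-from-gap (+ 6 * ∑[ i < a ] (deviation i * deviation i))
    (ℤP.*-monoˡ-≤-nonNeg (+ 6) (∑-nonNeg a (λ i → 0≤i*i (deviation i))))
    (regroup A G (∑[ i < a ] (deviation i * deviation i)) (begin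
      + 6 * ∑[ i < a ] (deviation i * deviation i)
        ≡⟨ cong (+ 6 *_) (∑-cong a (λ i _ → expand A (+ i) (+ s i))) ⟩
      + 6 * ∑[ i < a ] (A * A + (- (+ 2 * A)) * + i + (- (+ 2 * A)) * + s i + 1ℤ * (+ i * + i) + 1ℤ * (+ s i * + s i) + + 2 * (+ i * + s i))
        ≡⟨ ∑-quadratic-permutation (affine-isPermutation v b⊥a) (A * A) (- (+ 2 * A)) (- (+ 2 * A)) 1ℤ 1ℤ (+ 2) ⟩
      + 6 * (A * A) * A + + 3 * ((- (+ 2 * A)) + (- (+ 2 * A))) * (A * (A - 1ℤ)) + (1ℤ + 1ℤ) * (A * (A - 1ℤ) * (+ 2 * A - 1ℤ))
        + + 6 * + 2 * G
        ∎)))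
  where
  open ≡-Reasoning
  A = + a
  G = residueMoment b a v
  s : ℕ → ℕ
  s i = (b ℕ.* i ℕ.+ v) % a
  deviation : ℕ → ℤ
  deviation i = A - + i - + s i
  expand : ∀ A I S → (A - I - S) * (A - I - S) ≡
    A * A + (- (+ 2 * A)) * I + (- (+ 2 * A)) * S + 1ℤ * (I * I) + 1ℤ * (S * S) + + 2 * (I * S)
  expand A I S = solve (A ∷ I ∷ S ∷ [])
  regroup : ∀ A G Σ → + 6 * Σ ≡
    + 6 * (A * A) * A + + 3 * ((- (+ 2 * A)) + (- (+ 2 * A))) * (A * (A - 1ℤ)) + (1ℤ + 1ℤ) * (A * (A - 1ℤ) * (+ 2 * A - 1ℤ))
      + + 6 * + 2 * G →
    + 2 * (+ 6 * G) ≡ + 2 * (A * (A * A - + 3 * A - 1ℤ)) + + 6 * Σ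
  regroup A G Σ h = linear-combination (- 1ℤ) h (solve (A ∷ G ∷ Σ ∷ []))

-- Rationals as fractions of integers

fromℤ : ℤ → ℚ
fromℤ X = X ℚ./ 1

toℚᵘ-/ : ∀ p d → toℚᵘ (p ℚ./ suc d) ≃ᵘ mkℚᵘ p d
toℚᵘ-/ p d = ℚP.toℚᵘ-fromℚᵘ (mkℚᵘ p d)

fromℤ-+ : ∀ X Y → fromℤ (X + Y) ≡ fromℤ X ℚ.+ fromℤ Y
fromℤ-+ X Y = ℚP.toℚᵘ-injective (begin
  toℚᵘ (fromℤ (X + Y))                 ≈⟨ toℚᵘ-/ (X + Y) 0 ⟩
  mkℚᵘ (X + Y) 0                       ≈⟨ *≡* (cross-multiplied X Y) ⟩
  mkℚᵘ X 0 ℚᵘ.+ mkℚᵘ Y 0               ≈⟨ ℚᵘP.+-cong (toℚᵘ-/ X 0) (toℚᵘ-/ Y 0) ⟨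
  toℚᵘ (fromℤ X) ℚᵘ.+ toℚᵘ (fromℤ Y)   ≈⟨ ℚP.toℚᵘ-homo-+ (fromℤ X) (fromℤ Y) ⟨
  toℚᵘ (fromℤ X ℚ.+ fromℤ Y)           ∎)
  where
  open ℚᵘP.≃-Reasoning
  cross-multiplied : ∀ X Y → (X + Y) * + 1 ≡ (X * + 1 + Y * + 1) * + 1
  cross-multiplied = solve-∀

fromℤ-* : ∀ X Y → fromℤ (X * Y) ≡ fromℤ X ℚ.* fromℤ Y
fromℤ-* X Y = ℚP.toℚᵘ-injective (begin
  toℚᵘ (fromℤ (X * Y))                 ≈⟨ toℚᵘ-/ (X * Y) 0 ⟩
  mkℚᵘ (X * Y) 0                       ≈⟨ *≡* refl ⟩
  mkℚᵘ X 0 ℚᵘ.* mkℚᵘ Y 0               ≈⟨ ℚᵘP.*-cong (toℚᵘ-/ X 0) (toℚᵘ-/ Y 0) ⟨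
  toℚᵘ (fromℤ X) ℚᵘ.* toℚᵘ (fromℤ Y)   ≈⟨ ℚP.toℚᵘ-homo-* (fromℤ X) (fromℤ Y) ⟨
  toℚᵘ (fromℤ X ℚ.* fromℤ Y)           ∎)
  where open ℚᵘP.≃-Reasoning

fromℤ-neg : ∀ X → fromℤ (- X) ≡ ℚ.- fromℤ X
fromℤ-neg X = ℚP.toℚᵘ-injective (begin
  toℚᵘ (fromℤ (- X))       ≈⟨ toℚᵘ-/ (- X) 0 ⟩
  mkℚᵘ (- X) 0             ≈⟨ ℚᵘP.-‿cong (toℚᵘ-/ X 0) ⟨
  ℚᵘ.- toℚᵘ (fromℤ X)      ≈⟨ ℚP.toℚᵘ-homo‿- (fromℤ X) ⟨
  toℚᵘ (ℚ.- fromℤ X)       ∎)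
  where open ℚᵘP.≃-Reasoning

fromℤ-mono-≤ : ∀ {X Y} → X ≤ℤ Y → fromℤ X ≤ℚ fromℤ Y
fromℤ-mono-≤ {X} {Y} X≤Y = ℚP.toℚᵘ-cancel-≤
  (ℚᵘP.≤-respˡ-≃ (ℚᵘP.≃-sym (toℚᵘ-/ X 0)) (ℚᵘP.≤-respʳ-≃ (ℚᵘP.≃-sym (toℚᵘ-/ Y 0))
    (*≤* (ℤP.*-monoʳ-≤-nonNeg (+ 1) X≤Y))))

/-*-cancel : ∀ p d → p ℚ./ suc d ℚ.* fromℤ (+ suc d) ≡ fromℤ p
/-*-cancel p d = ℚP.toℚᵘ-injective (begin
  toℚᵘ (p ℚ./ suc d ℚ.* fromℤ (+ suc d))          ≈⟨ ℚP.toℚᵘ-homo-* (p ℚ./ suc d) (fromℤ (+ suc d)) ⟩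
  toℚᵘ (p ℚ./ suc d) ℚᵘ.* toℚᵘ (fromℤ (+ suc d))  ≈⟨ ℚᵘP.*-cong (toℚᵘ-/ p d) (toℚᵘ-/ (+ suc d) 0) ⟩
  mkℚᵘ p d ℚᵘ.* mkℚᵘ (+ suc d) 0                  ≈⟨ *≡* (trans (ℤP.*-identityʳ _) (cong (λ n → p * + suc n) (sym (ℕP.*-identityʳ d)))) ⟩
  mkℚᵘ p 0                                         ≈⟨ toℚᵘ-/ p 0 ⟨
  toℚᵘ (fromℤ p)                                   ∎)
  where open ℚᵘP.≃-Reasoning

-- p / (d + 1) is stored in lowest terms (p/g) / ((d + 1)/g); scaling the division bounds of the
-- reduced fraction by g gives those of p by d + 1.
floor-/ : ∀ p d → floor (p ℚ./ suc d) ≡ p /ℕ suc d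
floor-/ p d = begin
  floor x                   ≡⟨ floor≡↥/↧ x ⟩
  ↥ x ℤ./ ↧ x               ≡⟨ div-pos-is-/ℕ (↥ x) (↧ₙ x) ⟩
  F                         ≡⟨ /ℕ-unique F (suc d) F*[1+d]≤p p<[1+F]*[1+d] ⟨
  p /ℕ suc d                ∎
  where
  open ≡-Reasoning
  x = p ℚ./ suc d
  F = ↥ x /ℕ ↧ₙ x
  g = ℤGCD.gcd p (+ suc d)
  floor≡↥/↧ : ∀ y → floor y ≡ ↥ y ℤ./ ↧ y
  floor≡↥/↧ (mkℚ _ _ _) = refl
  g>0 : 0ℤ <ℤ g
  g>0 = +<+ (ℕP.n≢0⇒n>0 (gcd[m,n]≢0 ℤ.∣ p ∣ (suc d) (inj₂ λ ())))
  F*[1+d]≤p : F * + suc d ≤ℤ p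
  F*[1+d]≤p = subst₂ _≤ℤ_ (trans (ℤP.*-assoc F (↧ x) g) (cong (F *_) (ℚP.↧-/ p (suc d)))) (ℚP.↥-/ p (suc d))
    (ℤP.*-monoʳ-≤-nonNeg g {{ℤ.nonNegative (ℤP.<⇒≤ g>0)}} ([n/ℕd]*d≤n (↥ x) (↧ₙ x)))
  p<[1+F]*[1+d] : p <ℤ (1ℤ + F) * + suc d
  p<[1+F]*[1+d] = subst₂ _<ℤ_ (ℚP.↥-/ p (suc d)) (trans (ℤP.*-assoc (1ℤ + F) (↧ x) g) (cong ((1ℤ + F) *_) (ℚP.↧-/ p (suc d))))
    (ℤP.*-monoʳ-<-pos g {{ℤ.positive g>0}} (n<s[n/ℕd]*d (↥ x) (↧ₙ x)))

-- x ≐ X ÷ D says that x = X / D.  Rational (in)equalities are proved by bringing both sides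
-- to a common denominator D and comparing the integer numerators.
infix 4 _≐_÷_
record _≐_÷_ (x : ℚ) (X D : ℤ) : Set where
  constructor cleared
  field denominator-cleared : x ℚ.* fromℤ D ≡ fromℤ X

≐-+ : ∀ {x y X Y D} → x ≐ X ÷ D → y ≐ Y ÷ D → x ℚ.+ y ≐ X + Y ÷ D
≐-+ {x} {y} {X} {Y} {D} (cleared x*D≡X) (cleared y*D≡Y) = cleared (begin
  (x ℚ.+ y) ℚ.* fromℤ D                ≡⟨ ℚP.*-distribʳ-+ (fromℤ D) x y ⟩
  x ℚ.* fromℤ D ℚ.+ y ℚ.* fromℤ D      ≡⟨ cong₂ ℚ._+_ x*D≡X y*D≡Y ⟩
  fromℤ X ℚ.+ fromℤ Y                  ≡⟨ fromℤ-+ X Y ⟨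
  fromℤ (X + Y)                        ∎)
  where open ≡-Reasoning

≐-neg : ∀ {x X D} → x ≐ X ÷ D → ℚ.- x ≐ - X ÷ D
≐-neg {x} {X} {D} (cleared x*D≡X) = cleared (begin
  ℚ.- x ℚ.* fromℤ D       ≡⟨ ℚP.neg-distribˡ-* x (fromℤ D) ⟨
  ℚ.- (x ℚ.* fromℤ D)     ≡⟨ cong ℚ.-_ x*D≡X ⟩
  ℚ.- fromℤ X             ≡⟨ fromℤ-neg X ⟨
  fromℤ (- X)             ∎)
  where open ≡-Reasoning

≐-- : ∀ {x y X Y D} → x ≐ X ÷ D → y ≐ Y ÷ D → x ℚ.- y ≐ X - Y ÷ D
≐-- x≐ y≐ = ≐-+ x≐ (≐-neg y≐)

≐-* : ∀ {x y X Y D E} → x ≐ X ÷ D → y ≐ Y ÷ E → x ℚ.* y ≐ X * Y ÷ D * E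
≐-* {x} {y} {X} {Y} {D} {E} (cleared x*D≡X) (cleared y*E≡Y) = cleared (begin
  x ℚ.* y ℚ.* fromℤ (D * E)                ≡⟨ cong (x ℚ.* y ℚ.*_) (fromℤ-* D E) ⟩
  x ℚ.* y ℚ.* (fromℤ D ℚ.* fromℤ E)        ≡⟨ *-interchange x y (fromℤ D) (fromℤ E) ⟩
  x ℚ.* fromℤ D ℚ.* (y ℚ.* fromℤ E)        ≡⟨ cong₂ ℚ._*_ x*D≡X y*E≡Y ⟩
  fromℤ X ℚ.* fromℤ Y                      ≡⟨ fromℤ-* X Y ⟨
  fromℤ (X * Y)                            ∎)
  where open ≡-Reasoning

≐-over : ∀ {x X D D′} E → x ≐ X ÷ D → D * E ≡ D′ → x ≐ X * E ÷ D′
≐-over {x} {X} {D} E (cleared x*D≡X) refl = cleared (begin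
  x ℚ.* fromℤ (D * E)              ≡⟨ cong (x ℚ.*_) (fromℤ-* D E) ⟩
  x ℚ.* (fromℤ D ℚ.* fromℤ E)      ≡⟨ ℚP.*-assoc x (fromℤ D) (fromℤ E) ⟨
  x ℚ.* fromℤ D ℚ.* fromℤ E        ≡⟨ cong (ℚ._* fromℤ E) x*D≡X ⟩
  fromℤ X ℚ.* fromℤ E              ≡⟨ fromℤ-* X E ⟨
  fromℤ (X * E)                    ∎)
  where open ≡-Reasoning

≐-numerator : ∀ {x X X′ D} → x ≐ X ÷ D → X ≡ X′ → x ≐ X′ ÷ D
≐-numerator x≐ refl = x≐

≐-denominator : ∀ {x X D D′} → x ≐ X ÷ D → D ≡ D′ → x ≐ X ÷ D′
≐-denominator x≐ refl = x≐

fromℤ-≐ : ∀ D Y → fromℤ Y ≐ Y * D ÷ D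
fromℤ-≐ D Y = cleared (sym (fromℤ-* Y D))

0ℚ-≐ : ∀ D → ℚ.0ℚ ≐ 0ℤ ÷ D
0ℚ-≐ D = cleared (ℚP.*-zeroˡ (fromℤ D))

½-≐ : ℚ.½ ≐ 1ℤ ÷ + 2
½-≐ = cleared refl

/'-≐ : ∀ p d .{{_ : NonZero d}} → p /' d ≐ p ÷ + d
/'-≐ p (suc d) = cleared (/-*-cancel p d)

/'-≐-* : ∀ p m n .{{_ : NonZero m}} .{{_ : NonZero n}} → p /' (m ℕ.* n) ≐ p ÷ + m * + n
/'-≐-* p m n = ≐-denominator (/'-≐ p (m ℕ.* n) {{ℕP.m*n≢0 m n}}) (ℤP.pos-* m n)

/'-≐-** : ∀ p m n o .{{_ : NonZero m}} .{{_ : NonZero n}} .{{_ : NonZero o}} → p /' (m ℕ.* n ℕ.* o) ≐ p ÷ + m * + n * + o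
/'-≐-** p m n o = ≐-denominator (/'-≐ p (m ℕ.* n ℕ.* o) {{ℕP.m*n≢0 (m ℕ.* n) o {{ℕP.m*n≢0 m n}}}})
  (trans (ℤP.pos-* (m ℕ.* n) o) (cong (_* + o) (ℤP.pos-* m n)))

Σ<-≐ : ∀ n {f : ℕ → ℚ} {F : ℕ → ℤ} {D} → (∀ m → m < n → f m ≐ F m ÷ D) → Σ< n f ≐ ∑ n F ÷ D
Σ<-≐ zero    {D = D} _ = 0ℚ-≐ D
Σ<-≐ (suc n) f≐F = ≐-+ (Σ<-≐ n (λ m m<n → f≐F m (ℕP.m<n⇒m<1+n m<n))) (f≐F n ℕP.≤-refl)

≐-≤ : ∀ {x y X Y D} → 0ℤ <ℤ D → x ≐ X ÷ D → y ≐ Y ÷ D → X ≤ℤ Y → x ≤ℚ y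
≐-≤ {x} {y} {D = ℤ.+[1+ d ]} _ (cleared x*D≡X) (cleared y*D≡Y) X≤Y =
  ℚP.*-cancelʳ-≤-pos (fromℤ (+ suc d)) {{ℚP.normalize-pos (suc d) 1}}
    (subst₂ _≤ℚ_ (sym x*D≡X) (sym y*D≡Y) (fromℤ-mono-≤ X≤Y))
≐-≤ {D = + zero} (+<+ ()) _ _ _

saw-≐ : ∀ p c .{{_ : NonZero c}} → saw (p /' c) ≐ + 2 * + (p modℤ c) - + c ÷ + 2 * + c
saw-≐ p (suc c) = ≐-numerator
  (≐-- (≐-over (+ 2) (≐-- (/'-≐ p (suc c)) (fromℤ-≐ C F)) (ℤP.*-comm C (+ 2))) (≐-over C ½-≐ refl))
  (fractional-part p (+ (p %ℕ suc c)) F C (trans (a≡a%ℕn+[a/ℕn]*n p (suc c)) (cong (λ q → + (p %ℕ suc c) + q * C) (sym (floor-/ p c)))))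
  where
  C = + suc c
  F = floor (p ℚ./ suc c)
  fractional-part : ∀ p r F C → p ≡ r + F * C → (p - F * C) * + 2 - 1ℤ * C ≡ + 2 * r - C
  fractional-part p r F C eq = linear-combination (+ 2) eq (solve (p ∷ r ∷ F ∷ C ∷ []))

σ-≐ : ∀ b c t ainv .{{_ : NonZero c}} → Coprime (c₁ b c ainv) c →
  let C = + c; k = c₁ b c ainv; u = (- (ainv * t)) modℤ c in
  σ t b c ainv ≐ + 6 * (+ 4 * residueMoment k c u - C * C * C + + 2 * (C * C)) ÷ + 24 * (C * C)
σ-≐ b c@(suc _) t ainv k⊥c =
  ≐-numerator (≐-over (+ 6) (Σ<-≐ c summand-≐) (denominator C)) (trans (ℤP.*-comm _ (+ 6)) (begin
    + 6 * ∑[ m < c ] ((+ 2 * + f m - C) * (+ 2 * + m - C))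
      ≡⟨ cong (+ 6 *_) (∑-cong c (λ m _ → expand C (+ m) (+ f m))) ⟩
    + 6 * ∑[ m < c ] (C * C + (- (+ 2 * C)) * + m + (- (+ 2 * C)) * + f m + 0ℤ * (+ m * + m) + 0ℤ * (+ f m * + f m)
                      + + 4 * (+ m * + f m))
      ≡⟨ ∑-quadratic-permutation (affine-isPermutation u k⊥c) (C * C) (- (+ 2 * C)) (- (+ 2 * C)) 0ℤ 0ℤ (+ 4) ⟩
    + 6 * (C * C) * C + + 3 * ((- (+ 2 * C)) + (- (+ 2 * C))) * (C * (C - 1ℤ)) + (0ℤ + 0ℤ) * (C * (C - 1ℤ) * (+ 2 * C - 1ℤ))
      + + 6 * + 4 * residueMoment k c u
      ≡⟨ collect C (residueMoment k c u) ⟩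
    + 6 * (+ 4 * residueMoment k c u - C * C * C + + 2 * (C * C))
      ∎))
  where
  open ≡-Reasoning
  C = + c
  k = c₁ b c ainv
  u = (- (ainv * t)) modℤ c
  f : ℕ → ℕ
  f m = (k ℕ.* m ℕ.+ u) % c
  distribute : ∀ x B M t → - (x * (B * M + t)) ≡ - (x * B) * M + - (x * t)
  distribute x B M t = solve (x ∷ B ∷ M ∷ t ∷ [])
  residue : ∀ m → (- (ainv * (+ b * + m + t))) modℤ c ≡ f m
  residue m = trans (cong (_%ℕ c) (distribute ainv (+ b) (+ m) t)) (%ℕ-affine (- (ainv * + b)) (- (ainv * t)) m c)
  summand-≐ : ∀ m → m < c →
    saw ((- (ainv * (+ b * + m + t))) /' c) ℚ.* saw ((+ m) /' c) ≐ (+ 2 * + f m - C) * (+ 2 * + m - C) ÷ + 2 * C * (+ 2 * C)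
  summand-≐ m m<c = ≐-numerator (≐-* (saw-≐ (- (ainv * (+ b * + m + t))) c) (saw-≐ (+ m) c))
    (cong₂ (λ r s → (+ 2 * + r - C) * (+ 2 * + s - C)) (residue m) (m<n⇒m%n≡m m<c))
  denominator : ∀ C → + 2 * C * (+ 2 * C) * + 6 ≡ + 24 * (C * C)
  denominator C = solve (C ∷ [])
  expand : ∀ C M F → (+ 2 * F - C) * (+ 2 * M - C) ≡
    C * C + (- (+ 2 * C)) * M + (- (+ 2 * C)) * F + 0ℤ * (M * M) + 0ℤ * (F * F) + + 4 * (M * F)
  expand C M F = solve (C ∷ M ∷ F ∷ [])
  collect : ∀ C G →
    + 6 * (C * C) * C + + 3 * ((- (+ 2 * C)) + (- (+ 2 * C))) * (C * (C - 1ℤ)) + (0ℤ + 0ℤ) * (C * (C - 1ℤ) * (+ 2 * C - 1ℤ))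
      + + 6 * + 4 * G ≡
    + 6 * (+ 4 * G - C * C * C + + 2 * (C * C))
  collect C G = solve (C ∷ G ∷ [])

bound₁-≐ : ∀ c .{{_ : NonZero c}} → let C = + c in
  bound₁ c ≐ - (C * C * C) + + 4 * C - + 18 * (C * C) ÷ + 24 * (C * C)
bound₁-≐ c = combine (+ c) (/'-≐ (+ c) 24) (/'-≐-* (+ 1) 6 c) (/'-≐ (+ 3) 4)
  where
  -- The ring solver only accepts variables as atoms, hence the casts + c are abstracted as C.
  combine : ∀ {x y z} C → x ≐ C ÷ + 24 → y ≐ + 1 ÷ + 6 * C → z ≐ + 3 ÷ + 4 →
    ℚ.- x ℚ.+ y ℚ.- z ≐ - (C * C * C) + + 4 * C - + 18 * (C * C) ÷ + 24 * (C * C)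
  combine C x≐ y≐ z≐ = ≐-numerator
    (≐-- (≐-+ (≐-neg (≐-over (C * C) x≐ (solve (C ∷ [])))) (≐-over (+ 4 * C) y≐ (solve (C ∷ []))))
         (≐-over (+ 6 * (C * C)) z≐ (solve (C ∷ []))))
    (solve (C ∷ []))

bound₂-≐ : ∀ c k .{{_ : NonZero c}} .{{_ : NonZero k}} → let C = + c; K = + k in
  bound₂ c k ≐ + 2 * K * K * K * C + + 2 * K * C - K * C * C * C - + 4 * K * C * C - + 2 * K * K * K * C * C - + 18 * K * K * C * C
             ÷ + 24 * K * K * C * C
bound₂-≐ c k = combine (+ k) (+ c) (/'-≐-* (+ k) 12 c) (/'-≐-** (+ 1) 12 k c) (/'-≐-* (+ c) 24 k) (/'-≐-* (+ 1) 6 k)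
  (/'-≐ (+ k) 12) (/'-≐ (+ 3) 4)
  where
  combine : ∀ {t₁ t₂ t₃ t₄ t₅ t₆} K C →
    t₁ ≐ K ÷ + 12 * C → t₂ ≐ + 1 ÷ + 12 * K * C → t₃ ≐ C ÷ + 24 * K → t₄ ≐ + 1 ÷ + 6 * K → t₅ ≐ K ÷ + 12 → t₆ ≐ + 3 ÷ + 4 →
    t₁ ℚ.+ t₂ ℚ.- t₃ ℚ.- t₄ ℚ.- t₅ ℚ.- t₆ ≐
      + 2 * K * K * K * C + + 2 * K * C - K * C * C * C - + 4 * K * C * C - + 2 * K * K * K * C * C - + 18 * K * K * C * C
      ÷ + 24 * K * K * C * C
  combine K C h₁ h₂ h₃ h₄ h₅ h₆ = ≐-numerator
    (≐-- (≐-- (≐-- (≐-- (≐-+ (≐-over (+ 2 * K * K * C) h₁ (solve (K ∷ C ∷ [])))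
                             (≐-over (+ 2 * K * C) h₂ (solve (K ∷ C ∷ []))))
                        (≐-over (K * C * C) h₃ (solve (K ∷ C ∷ []))))
                   (≐-over (+ 4 * K * C * C) h₄ (solve (K ∷ C ∷ []))))
              (≐-over (+ 2 * K * K * C * C) h₅ (solve (K ∷ C ∷ []))))
         (≐-over (+ 6 * K * K * C * C) h₆ (solve (K ∷ C ∷ []))))
    (solve (K ∷ C ∷ []))

bound₃-≐ : ∀ c k l .{{_ : NonZero c}} .{{_ : NonZero k}} .{{_ : NonZero l}} → let C = + c; K = + k; L = + l in
  bound₃ c k l ≐ + 2 * K * K * K * L * L * C + + 2 * K * L * L * C - K * L * L * C * C * C - + 2 * K * L * L * L * C * C
                 - + 2 * K * L * C * C - + 2 * K * K * K * L * C * C - + 18 * K * K * L * L * C * C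
               ÷ + 24 * K * K * L * L * C * C
bound₃-≐ c k l = combine (+ k) (+ c) (+ l) (/'-≐-* (+ k) 12 c) (/'-≐-** (+ 1) 12 k c) (/'-≐-* (+ c) 24 k) (/'-≐-* (+ l) 12 k)
  (/'-≐-** (+ 1) 12 k l) (/'-≐-* (+ k) 12 l) (/'-≐ (+ 3) 4)
  where
  combine : ∀ {t₁ t₂ t₃ t₄ t₅ t₆ t₇} K C L →
    t₁ ≐ K ÷ + 12 * C → t₂ ≐ + 1 ÷ + 12 * K * C → t₃ ≐ C ÷ + 24 * K → t₄ ≐ L ÷ + 12 * K → t₅ ≐ + 1 ÷ + 12 * K * L →
    t₆ ≐ K ÷ + 12 * L → t₇ ≐ + 3 ÷ + 4 →
    t₁ ℚ.+ t₂ ℚ.- t₃ ℚ.- t₄ ℚ.- t₅ ℚ.- t₆ ℚ.- t₇ ≐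
      + 2 * K * K * K * L * L * C + + 2 * K * L * L * C - K * L * L * C * C * C - + 2 * K * L * L * L * C * C
      - + 2 * K * L * C * C - + 2 * K * K * K * L * C * C - + 18 * K * K * L * L * C * C
      ÷ + 24 * K * K * L * L * C * C
  combine K C L h₁ h₂ h₃ h₄ h₅ h₆ h₇ = ≐-numerator
    (≐-- (≐-- (≐-- (≐-- (≐-- (≐-+ (≐-over (+ 2 * K * K * L * L * C) h₁ (solve (K ∷ C ∷ L ∷ [])))
                                  (≐-over (+ 2 * K * L * L * C) h₂ (solve (K ∷ C ∷ L ∷ []))))
                             (≐-over (K * L * L * C * C) h₃ (solve (K ∷ C ∷ L ∷ []))))
                        (≐-over (+ 2 * K * L * L * C * C) h₄ (solve (K ∷ C ∷ L ∷ []))))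
                   (≐-over (+ 2 * K * L * C * C) h₅ (solve (K ∷ C ∷ L ∷ []))))
              (≐-over (+ 2 * K * K * L * C * C) h₆ (solve (K ∷ C ∷ L ∷ []))))
         (≐-over (+ 6 * K * K * L * L * C * C) h₇ (solve (K ∷ C ∷ L ∷ []))))
    (solve (K ∷ C ∷ L ∷ []))

radicand-factor-≐ : ∀ c k l .{{_ : NonZero l}} → let C = + c; K = + k; L = + l in
  (+ l) /' 12 ℚ.- (+ 1) /' 4 ℚ.+ (+ 1) /' (6 ℕ.* l) ≐ + 2 * K * K * L * (L - 1ℤ) * (L - + 2) * C * C ÷ + 24 * K * K * L * L * C * C
radicand-factor-≐ c k l = combine (+ k) (+ c) (+ l) (/'-≐ (+ l) 12) (/'-≐ (+ 1) 4) (/'-≐-* (+ 1) 6 l)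
  where
  combine : ∀ {t₁ t₂ t₃} K C L → t₁ ≐ L ÷ + 12 → t₂ ≐ + 1 ÷ + 4 → t₃ ≐ + 1 ÷ + 6 * L →
    t₁ ℚ.- t₂ ℚ.+ t₃ ≐ + 2 * K * K * L * (L - 1ℤ) * (L - + 2) * C * C ÷ + 24 * K * K * L * L * C * C
  combine K C L h₁ h₂ h₃ = ≐-numerator
    (≐-+ (≐-- (≐-over (+ 2 * K * K * L * L * C * C) h₁ (solve (K ∷ C ∷ L ∷ [])))
              (≐-over (+ 6 * K * K * L * L * C * C) h₂ (solve (K ∷ C ∷ L ∷ []))))
         (≐-over (+ 4 * K * K * L * C * C) h₃ (solve (K ∷ C ∷ L ∷ []))))
    (solve (K ∷ C ∷ L ∷ []))

-- The three cases

bound₁-inequality : ∀ {c u G : ℤ} → 0ℤ ≤ℤ c →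
  + 12 * (+ 1 * + 1) * G + + 12 * (c * c) * 0ℤ ≡
    + 1 * c * (+ 1 * + 1 + c * c + 1ℤ + + 3 * + 1 * c * (+ 1 + c - + 3)) - + 6 * + 1 * c * u * (+ 1 + c - 1ℤ - u) →
  - (c * c * c) + + 4 * c - + 18 * (c * c) ≤ℤ + 6 * (+ 4 * G - c * c * c + + 2 * (c * c))
bound₁-inequality {c} {u} {G} 0≤c reciprocity =
  ≤-from-gap _ 0≤gap (linear-combination (+ 2) reciprocity (solve (c ∷ u ∷ G ∷ [])))
  where
  0≤gap : 0ℤ ≤ℤ + 3 * c * ((c - + 2 * u) * (c - + 2 * u)) + + 18 * (c * c)
  0≤gap = 0≤+ 3 ⟨*⟩ 0≤c ⟨*⟩ 0≤i*i (c - + 2 * u) ⟨+⟩ 0≤+ 18 ⟨*⟩ (0≤c ⟨*⟩ 0≤c)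

-- Adding 2l² times the first reciprocity law and -2c² times the second eliminates G₁ and G₂;
-- what remains is an explicit nonnegative gap.
bound₃-inequality : ∀ {k c l u u′ G₁ G₂ G₃ : ℤ} →
  0ℤ ≤ℤ u′ → 0ℤ ≤ℤ k - u′ → 0ℤ ≤ℤ c - (1ℤ + k) → 0ℤ ≤ℤ l - 1ℤ →
  + 12 * (k * k) * G₁ + + 12 * (c * c) * G₂ ≡
    k * c * (k * k + c * c + 1ℤ + + 3 * k * c * (k + c - + 3)) - + 6 * k * c * u * (k + c - 1ℤ - u) →
  + 12 * (l * l) * G₂ + + 12 * (k * k) * G₃ ≡
    l * k * (l * l + k * k + 1ℤ + + 3 * l * k * (l + k - + 3)) - + 6 * l * k * u′ * (l + k - 1ℤ - u′) →
  l * (l * l - + 3 * l - 1ℤ) ≤ℤ + 6 * G₃ →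
  + 2 * k * k * k * l * l * c + + 2 * k * l * l * c - k * l * l * c * c * c - + 2 * k * l * l * l * c * c
    - + 2 * k * l * c * c - + 2 * k * k * k * l * c * c - + 18 * k * k * l * l * c * c
    - + 6 * (+ 4 * G₁ - c * c * c + + 2 * (c * c)) * (k * k * l * l)
  ≤ℤ + 2 * k * k * l * (l - 1ℤ) * (l - + 2) * c * c
bound₃-inequality {k} {c} {l} {u} {u′} {G₁} {G₂} {G₃} 0≤u′ 0≤k-u′ 0≤c-[1+k] 0≤l-1 reciprocity₁ reciprocity₂ G₃-bound =
  ≤-from-gap _ 0≤gap
    (linear-combination (+ 2 * (l * l)) reciprocity₁ (linear-combination (- (+ 2 * (c * c))) reciprocity₂
      (solve (k ∷ c ∷ l ∷ u ∷ u′ ∷ G₁ ∷ G₂ ∷ G₃ ∷ []))))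
  where
  0≤k : 0ℤ ≤ℤ k
  0≤k = subst (0ℤ ≤ℤ_) {u′ + (k - u′)} (solve (k ∷ u′ ∷ [])) (0≤u′ ⟨+⟩ 0≤k-u′)
  0≤l : 0ℤ ≤ℤ l
  0≤l = subst (0ℤ ≤ℤ_) {l - 1ℤ + + 1} (solve (l ∷ [])) (0≤l-1 ⟨+⟩ 0≤+ 1)
  0≤c : 0ℤ ≤ℤ c
  0≤c = subst (0ℤ ≤ℤ_) {c - (1ℤ + k) + (+ 1 + k)} (solve (c ∷ k ∷ [])) (0≤c-[1+k] ⟨+⟩ (0≤+ 1 ⟨+⟩ 0≤k))
  0≤gap : 0ℤ ≤ℤ + 3 * l * l * k * c * ((k + c - 1ℤ - + 2 * u) * (k + c - 1ℤ - + 2 * u))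
      + + 12 * c * c * l * k * u′ * ((l - 1ℤ) + (k - u′))
      + + 3 * k * l * l * c * (k * k + + 6 * k + 1ℤ + + 2 * k * (c - (1ℤ + k)) + + 2 * (c - (1ℤ + k)))
      + + 4 * c * c * k * k * (+ 6 * G₃ - l * (l * l - + 3 * l - 1ℤ))
  0≤gap = 0≤+ 3 ⟨*⟩ 0≤l ⟨*⟩ 0≤l ⟨*⟩ 0≤k ⟨*⟩ 0≤c ⟨*⟩ 0≤i*i (k + c - 1ℤ - + 2 * u)
    ⟨+⟩ 0≤+ 12 ⟨*⟩ 0≤c ⟨*⟩ 0≤c ⟨*⟩ 0≤l ⟨*⟩ 0≤k ⟨*⟩ 0≤u′ ⟨*⟩ (0≤l-1 ⟨+⟩ 0≤k-u′)
    ⟨+⟩ 0≤+ 3 ⟨*⟩ 0≤k ⟨*⟩ 0≤l ⟨*⟩ 0≤l ⟨*⟩ 0≤c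
          ⟨*⟩ (0≤k ⟨*⟩ 0≤k ⟨+⟩ 0≤+ 6 ⟨*⟩ 0≤k ⟨+⟩ 0≤+ 1 ⟨+⟩ 0≤+ 2 ⟨*⟩ 0≤k ⟨*⟩ 0≤c-[1+k] ⟨+⟩ 0≤+ 2 ⟨*⟩ 0≤c-[1+k])
    ⟨+⟩ 0≤+ 4 ⟨*⟩ 0≤c ⟨*⟩ 0≤c ⟨*⟩ 0≤k ⟨*⟩ 0≤k ⟨*⟩ ℤP.i≤j⇒0≤j-i G₃-bound

≥-√-intro : ∀ {x y q r} → y ℚ.- x ≤ℚ q → ℚ.0ℚ ≤ℚ q → q ≤ℚ r → x ≥ y -√ (r ℚ.* q)
≥-√-intro {x} {y} {q} {r} δ≤q 0≤q q≤r with y ℚ.- x ℚP.≤? ℚ.0ℚ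
... | yes δ≤0 = inj₁ δ≤0
... | no  δ≰0 = inj₂ (begin
  δ ℚ.* δ   ≤⟨ ℚP.*-monoˡ-≤-nonNeg δ {{ℚ.nonNegative 0≤δ}} δ≤q ⟩
  δ ℚ.* q   ≤⟨ ℚP.*-monoʳ-≤-nonNeg q {{ℚ.nonNegative 0≤q}} δ≤q ⟩
  q ℚ.* q   ≤⟨ ℚP.*-monoʳ-≤-nonNeg q {{ℚ.nonNegative 0≤q}} q≤r ⟩
  r ℚ.* q   ∎)
  where
  open ℚP.≤-Reasoning
  δ = y ℚ.- x
  0≤δ : ℚ.0ℚ ≤ℚ δ
  0≤δ = ℚP.<⇒≤ (ℚP.≰⇒> δ≰0)

radicand-factors-≤ : ∀ l → (+ l) /' 12 ℚ.- (+ 1) /' 4 ℚ.+ (+ 1) /' (6 ℕ.* l) ≤ℚ (+ l) /' 12 ℚ.+ (+ 1) /' (6 ℕ.* l)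
radicand-factors-≤ l = ℚP.+-monoˡ-≤ ((+ 1) /' (6 ℕ.* l)) (begin
  (+ l) /' 12 ℚ.- (+ 1) /' 4   ≤⟨ ℚP.+-monoʳ-≤ ((+ l) /' 12) (ℚ.*≤* ℤ.-≤+) ⟩
  (+ l) /' 12 ℚ.+ ℚ.0ℚ         ≡⟨ ℚP.+-identityʳ ((+ l) /' 12) ⟩
  (+ l) /' 12                  ∎)
  where open ℚP.≤-Reasoning

-- For a = 1 the second term of the reciprocity law is G(c mod 1, 1, u mod 1), a single summand
-- with weight m = 0, so it reduces to 0ℤ.
bound₁≤σ : ∀ {σ c k u} .{{_ : NonZero c}} → u < c → k ≡ 1 → let C = + c in
  σ ≐ + 6 * (+ 4 * residueMoment k c u - C * C * C + + 2 * (C * C)) ÷ + 24 * (C * C) →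
  bound₁ c ≤ℚ σ
bound₁≤σ {c = c@(suc _)} {u = u} u<c refl σ≐ = ≐-≤ (+<+ z<s) (bound₁-≐ c) σ≐
  (bound₁-inequality {+ c} {+ u} {residueMoment 1 c u} (0≤+ c) (reciprocity u<c (Coprimality.1-coprimeTo c)))

-- Case (ii) is the instance l = 1 of bound₃-inequality: there the numerators of bound₃ c k 1 and
-- bound₂ c k agree, G(k mod 1, 1, _) = 0, and the radicand factor vanishes.
bound₂≤σ : ∀ {σ c k u} .{{_ : NonZero c}} .{{_ : NonZero k}} → u < c → k < c → Coprime k c → c % k ≡ 1 →
  let C = + c in
  σ ≐ + 6 * (+ 4 * residueMoment k c u - C * C * C + + 2 * (C * C)) ÷ + 24 * (C * C) →
  bound₂ c k ≤ℚ σ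
bound₂≤σ {σ} {c@(suc _)} {k@(suc _)} {u} u<c k<c k⊥c c%k≡1 σ≐ =
  ≐-≤ (+<+ z<s) (bound₂-≐ c k) (rescale (+ k) (+ c) σ≐) (specialise (+ k) (+ c) S
    (bound₃-inequality {+ k} {+ c} {+ 1} {+ u} {+ u′} {residueMoment k c u} {residueMoment 1 k u′} {0ℤ}
      (0≤+ u′) (ℤP.i≤j⇒0≤j-i (+≤+ (ℕP.<⇒≤ u′<k))) (ℤP.i≤j⇒0≤j-i (+≤+ k<c)) (0≤+ 0)
      (trans (cong (λ l → + 12 * (+ k * + k) * residueMoment k c u + + 12 * (+ c * + c) * residueMoment l k u′) (sym c%k≡1))
        (reciprocity u<c k⊥c))
      (reciprocity u′<k (Coprimality.1-coprimeTo k))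
      ℤ.-≤+))
  where
  S = + 6 * (+ 4 * residueMoment k c u - + c * + c * + c + + 2 * (+ c * + c))
  u′ = u % k
  u′<k : u′ < k
  u′<k = m%n<n u k
  rescale : ∀ {x X} K C → x ≐ X ÷ + 24 * (C * C) → x ≐ X * (K * K) ÷ + 24 * K * K * C * C
  rescale K C x≐ = ≐-over (K * K) x≐ (solve (K ∷ C ∷ []))
  specialise : ∀ K C S →
    + 2 * K * K * K * + 1 * + 1 * C + + 2 * K * + 1 * + 1 * C - K * + 1 * + 1 * C * C * C - + 2 * K * + 1 * + 1 * + 1 * C * C
      - + 2 * K * + 1 * C * C - + 2 * K * K * K * + 1 * C * C - + 18 * K * K * + 1 * + 1 * C * C - S * (K * K * + 1 * + 1)
      ≤ℤ + 2 * K * K * + 1 * (+ 1 - 1ℤ) * (+ 1 - + 2) * C * C →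
    + 2 * K * K * K * C + + 2 * K * C - K * C * C * C - + 4 * K * C * C - + 2 * K * K * K * C * C - + 18 * K * K * C * C
      ≤ℤ S * (K * K)
  specialise K C S h = ℤP.i-j≤0⇒i≤j (begin
    + 2 * K * K * K * C + + 2 * K * C - K * C * C * C - + 4 * K * C * C - + 2 * K * K * K * C * C - + 18 * K * K * C * C
      - S * (K * K)
      ≡⟨ solve (K ∷ C ∷ S ∷ []) ⟩
    + 2 * K * K * K * + 1 * + 1 * C + + 2 * K * + 1 * + 1 * C - K * + 1 * + 1 * C * C * C - + 2 * K * + 1 * + 1 * + 1 * C * C
      - + 2 * K * + 1 * C * C - + 2 * K * K * K * + 1 * C * C - + 18 * K * K * + 1 * + 1 * C * C - S * (K * K * + 1 * + 1)
      ≤⟨ h ⟩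
    + 2 * K * K * + 1 * (+ 1 - 1ℤ) * (+ 1 - + 2) * C * C
      ≡⟨ solve (K ∷ C ∷ []) ⟩
    0ℤ
      ∎)
    where open ℤP.≤-Reasoning

σ≥bound₃-√radicand₃ : ∀ {σ c k u l} .{{_ : NonZero c}} .{{_ : NonZero k}} → u < c → k < c → Coprime k c → k ≢ 1 →
  c % k ≡ l → l ≢ 1 → let C = + c in
  σ ≐ + 6 * (+ 4 * residueMoment k c u - C * C * C + + 2 * (C * C)) ÷ + 24 * (C * C) →
  σ ≥ bound₃ c k l -√ radicand₃ l
σ≥bound₃-√radicand₃ {l = zero} {{_}} {{k≢0}} _ _ k⊥c k≢1 c%k≡0 _ _ =
  ⊥-elim (k≢1 (k⊥c (ℕ∣.∣-refl , ℕ∣.m%n≡0⇒n∣m _ _ {{k≢0}} c%k≡0)))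
σ≥bound₃-√radicand₃ {l = suc zero} _ _ _ _ _ l≢1 _ = ⊥-elim (l≢1 refl)
σ≥bound₃-√radicand₃ {σ} {c@(suc _)} {k@(suc _)} {u} {l@(suc (suc _))} u<c k<c k⊥c _ c%k≡l _ σ≐ =
  ≥-√-intro {σ} {bound₃ c k l} bound₃-σ≤q 0≤q (radicand-factors-≤ l)
  where
  u′ = u % k
  u′<k : u′ < k
  u′<k = m%n<n u k
  l⊥k : Coprime l k
  l⊥k = subst (λ l → Coprime l k) c%k≡l (coprime-% (Coprimality.sym k⊥c))
  1≤l : + 1 ≤ℤ + l
  1≤l = +≤+ (s≤s z≤n)
  2≤l : + 2 ≤ℤ + l
  2≤l = +≤+ (s≤s (s≤s z≤n))
  D>0 : 0ℤ <ℤ + 24 * + k * + k * + l * + l * + c * + c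
  D>0 = +<+ z<s
  rescale : ∀ {x X} K C L → x ≐ X ÷ + 24 * (C * C) → x ≐ X * (K * K * L * L) ÷ + 24 * K * K * L * L * C * C
  rescale K C L x≐ = ≐-over (K * K * L * L) x≐ (solve (K ∷ C ∷ L ∷ []))
  bound₃-σ≤q : bound₃ c k l ℚ.- σ ≤ℚ (+ l) /' 12 ℚ.- (+ 1) /' 4 ℚ.+ (+ 1) /' (6 ℕ.* l)
  bound₃-σ≤q = ≐-≤ D>0 (≐-- (bound₃-≐ c k l) (rescale (+ k) (+ c) (+ l) σ≐)) (radicand-factor-≐ c k l)
    (bound₃-inequality {+ k} {+ c} {+ l} {+ u} {+ u′} {residueMoment k c u} {residueMoment l k u′} {residueMoment (k % l) l (u′ % l)}
      (0≤+ u′) (ℤP.i≤j⇒0≤j-i (+≤+ (ℕP.<⇒≤ u′<k))) (ℤP.i≤j⇒0≤j-i (+≤+ k<c)) (ℤP.i≤j⇒0≤j-i 1≤l)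
      (trans (cong (λ l → + 12 * (+ k * + k) * residueMoment k c u + + 12 * (+ c * + c) * residueMoment l k u′) (sym c%k≡l))
        (reciprocity u<c k⊥c))
      (reciprocity u′<k l⊥k)
      (residueMoment-lower-bound (u′ % l) (coprime-% (Coprimality.sym l⊥k))))
  0≤q : ℚ.0ℚ ≤ℚ (+ l) /' 12 ℚ.- (+ 1) /' 4 ℚ.+ (+ 1) /' (6 ℕ.* l)
  0≤q = ≐-≤ D>0 (0ℚ-≐ _) (radicand-factor-≐ c k l)
    (0≤+ 2 ⟨*⟩ 0≤+ k ⟨*⟩ 0≤+ k ⟨*⟩ 0≤+ l ⟨*⟩ ℤP.i≤j⇒0≤j-i 1≤l ⟨*⟩ ℤP.i≤j⇒0≤j-i 2≤l ⟨*⟩ 0≤+ c ⟨*⟩ 0≤+ c)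

c₁-coprime : ∀ {a b c} ainv .{{_ : NonZero c}} → gcd b c ≡ 1 → (+ c) ∣ (+ a * ainv - + 1) → Coprime (c₁ b c ainv) c
c₁-coprime {a} {b} {c@(suc _)} ainv gcd[b,c]≡1 c∣aa⁻¹-1 {d} (d∣k , d∣c) =
  ℕ∣.∣1⇒≡1 (subst (d ℕ∣.∣_) gcd[b,c]≡1 (gcd-greatest (ℤ∣.∣⇒∣ᵤ d∣b) d∣c))
  where
  d∣c′ : + d ℤ∣.∣ + c
  d∣c′ = ℤ∣.∣ᵤ⇒∣ {+ d} {+ c} d∣c
  d∣−ainv*b : + d ℤ∣.∣ - (ainv * + b)
  d∣−ainv*b = subst (+ d ℤ∣.∣_) (sym (a≡a%ℕn+[a/ℕn]*n (- (ainv * + b)) c))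
    (ℤ∣.∣m∣n⇒∣m+n (ℤ∣.∣ᵤ⇒∣ {+ d} {+ c₁ b c ainv} d∣k) (ℤ∣.∣n⇒∣m*n (- (ainv * + b) /ℕ c) d∣c′))
  d∣aa⁻¹-1 : + d ℤ∣.∣ + a * ainv - + 1
  d∣aa⁻¹-1 = ℤ∣.∣-trans d∣c′ (ℤ∣.∣ᵤ⇒∣ {+ c} {+ a * ainv - + 1} c∣aa⁻¹-1)
  cancel-inverse : ∀ A x B → (- A) * - (x * B) - (A * x - + 1) * B ≡ B
  cancel-inverse A x B = solve (A ∷ x ∷ B ∷ [])
  d∣b : + d ℤ∣.∣ + b
  d∣b = subst (+ d ℤ∣.∣_) (cancel-inverse (+ a) ainv (+ b))
    (ℤ∣.∣m∣n⇒∣m-n (ℤ∣.∣n⇒∣m*n (- + a) d∣−ainv*b) (ℤ∣.∣m⇒∣m*n (+ b) d∣aa⁻¹-1))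

mainTheorem1 : (a b c : ℕ) → 1 ≤ a → 1 ≤ b → 2 ≤ c →
    gcd a c ≡ 1 → gcd b c ≡ 1 → (t ainv : ℤ) → (+ c) ∣ (+ a * ainv - + 1) →
    (c₁ b c ainv ≡ 1 → bound₁ c ≤ℚ σ t b c ainv)
    × (c₁ b c ainv ≢ 1 → c₂ b c ainv ≡ 1 →
         bound₂ c (c₁ b c ainv) ≤ℚ σ t b c ainv)
    × (c₁ b c ainv ≢ 1 → c₂ b c ainv ≢ 1 →
         σ t b c ainv ≥ bound₃ c (c₁ b c ainv) (c₂ b c ainv) -√ radicand₃ (c₂ b c ainv))
mainTheorem1 a b c@(suc (suc _)) _ _ (s≤s (s≤s z≤n)) _ gcd[b,c]≡1 t ainv c∣aa⁻¹-1 =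
    (λ k≡1 → bound₁≤σ u<c k≡1 σ≐)
  , (λ _ l≡1 → bound₂≤σ u<c k<c k⊥c (trans (sym (modℕ≡% c k)) l≡1) σ≐)
  , (λ k≢1 l≢1 → σ≥bound₃-√radicand₃ u<c k<c k⊥c k≢1 (sym (modℕ≡% c k)) l≢1 σ≐)
  where
  k = c₁ b c ainv
  k⊥c : Coprime k c
  k⊥c = c₁-coprime {a} ainv gcd[b,c]≡1 c∣aa⁻¹-1
  instance
    k≢0 : NonZero k
    k≢0 = ℕ.≢-nonZero (λ k≡0 → Coprimality.¬0-coprimeTo-2+ (subst (λ k → Coprime k c) k≡0 k⊥c))
  u<c : (- (ainv * t)) modℤ c < c
  u<c = n%ℕd<d (- (ainv * t)) c
  k<c : k < c
  k<c = n%ℕd<d (- (ainv * + b)) c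
  σ≐ = σ-≐ b c t ainv k⊥c
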